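{- Let $\mathbb T$ be the Terwilliger $\mathbb F$-algebra of the factorial association scheme with parameters $u_1,\dots,u_n$ with respect to a point $\mathbf x$, and let $n_2=|\{a: u_a>2\}|$. Then $\dim_{\mathbb F}\mathrm Z(\mathbb T)=2^{n_2}$; in particular, the $\mathbb F$-dimension of the center $\mathrm Z(\mathbb T)$ does not depend on the field $\mathbb F$.
   Context: Let $n\ge1$ and let $\mathbb U_1,\dots,\mathbb U_n$ be finite sets with $|\mathbb U_a|=u_a\ge2$. Put $\mathbb X=\prod_a\mathbb U_a$, $d=2^n-1$. For $g\in[0,d]$ with binary expansion $g=\sum_{a=1}^n g_{(a)}2^{a-1}$ let $\mathbb P(g)=\{a:g_{(a)}=1\}$ and $R_g=\{(\mathbf u,\mathbf v)\in\mathbb X^2:\mathbf u_a\ne\mathbf v_a\iff a\in\mathbb P(g)\}$; $\{R_0,\dots,R_d\}$ is the factorial association scheme. For a field $\mathbb F$, $A_g$ is the $\{0,1\}$ adjacency matrix of $R_g$ in $M_{\mathbb X}(\mathbb F)$; fixing $\mathbf x\in\mathbb X$, $E_g^*$ is the diagonal $\{0,1\}$-matrix with $E_g^*(\mathbf u,\mathbf u)=1$ iff $(\mathbf x,\mathbf u)\in R_g$; $\mathbb T$ is the subalgebra of $M_{\mathbb X}(\mathbb F)$ generated by all $A_g,E_g^*$, and $\mathrm Z(\mathbb T)$ is its center. -}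

module Defs where

open import Level using (Level; _⊔_)
open import Data.Nat as ℕ using (ℕ; zero; suc; _<_; _≤_)
open import Data.Nat.Properties using (_<?_)
open import Data.Fin as Fin using (Fin; zero; suc)
open import Data.Fin.Subset using (Subset)
open import Data.Bool using (Bool; true; false; not; _∧_; _xor_; if_then_else_)
open import Data.List using (List; []; _∷_; concatMap; map; foldr; allFin)
open import Data.Vec using (lookup)
open import Data.Vec.Functional using (Vector)
open import Data.Product using (Σ; _×_; _,_; ∃)
open import Relation.Nullary using (¬_; does)
open import Relation.Binary.PropositionalEquality using (_≡_)
open import Algebra.Bundles using (CommutativeRing)

record Field (c ℓ : Level) : Set (Level.suc (c ⊔ ℓ)) where
  field
    commutativeRing : CommutativeRing c ℓ
  open CommutativeRing commutativeRing public
  field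
    0≉1     : ¬ (0# ≈ 1#)
    inverse : ∀ x → ¬ (x ≈ 0#) → Σ Carrier λ y → x * y ≈ 1#

allB : ∀ {n} → (Fin n → Bool) → Bool
allB {zero}  f = true
allB {suc n} f = f zero ∧ allB (λ a → f (suc a))

countB : ∀ {n} → (Fin n → Bool) → ℕ
countB {zero}  f = 0
countB {suc n} f = (if f zero then 1 else 0) ℕ.+ countB (λ a → f (suc a))

Point : ∀ {n} → (Fin n → ℕ) → Set
Point {n} u = (a : Fin n) → Fin (u a)

allPoints : ∀ {n} (u : Fin n → ℕ) → List (Point u)
allPoints {zero}  u = (λ ()) ∷ []
allPoints {suc n} u =
  concatMap (λ i → map (λ f → cons i f) (allPoints (λ a → u (suc a))))
            (allFin (u zero))
  where
  cons : Fin (u zero) → Point (λ a → u (suc a)) → Point u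
  cons i f zero    = i
  cons i f (suc a) = f a

_==ₚ_ : ∀ {n} {u : Fin n → ℕ} → Point u → Point u → Bool
p ==ₚ q = allB (λ a → does (p a Fin.≟ q a))

-- (p , q) ∈ R_g  where g ⊆ [n] plays the role of ℙ(g):
-- p_a ≠ q_a  iff  a ∈ g
inR : ∀ {n} {u : Fin n → ℕ} → Subset n → Point u → Point u → Bool
inR g p q = allB (λ a → not (not (does (p a Fin.≟ q a)) xor lookup g a))

n₂ : ∀ {n} → (Fin n → ℕ) → ℕ
n₂ u = countB (λ a → does (2 <? u a))

module Terwilliger {c ℓ} (F : Field c ℓ) {n : ℕ} (u : Fin n → ℕ) (x : Point u) where
  open Field F using (Carrier; _≈_; _+_; _*_; 0#; 1#)

  Mat : Set c
  Mat = Point u → Point u → Carrier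

  _≈ₘ_ : Mat → Mat → Set ℓ
  M ≈ₘ N = ∀ p q → M p q ≈ N p q

  0ₘ : Mat
  0ₘ _ _ = 0#

  _+ₘ_ : Mat → Mat → Mat
  (M +ₘ N) p q = M p q + N p q

  _·ₘ_ : Carrier → Mat → Mat
  (k ·ₘ M) p q = k * M p q

  _*ₘ_ : Mat → Mat → Mat
  (M *ₘ N) p q = foldr (λ w s → M p w * N w q + s) 0# (allPoints u)

  bool : Bool → Carrier
  bool b = if b then 1# else 0#

  A : Subset n → Mat
  A g p q = bool (inR g p q)

  E* : Subset n → Mat
  E* g p q = bool ((p ==ₚ q) ∧ inR g x p)

  data InT : Mat → Set (c ⊔ ℓ) where
    genA  : ∀ g → InT (A g)
    genE  : ∀ g → InT (E* g)
    zeroT : InT 0ₘ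
    plus  : ∀ {M N} → InT M → InT N → InT (M +ₘ N)
    scale : ∀ k {M} → InT M → InT (k ·ₘ M)
    times : ∀ {M N} → InT M → InT N → InT (M *ₘ N)
    resp  : ∀ {M N} → M ≈ₘ N → InT M → InT N

  InZ : Mat → Set (c ⊔ ℓ)
  InZ M = InT M × (∀ N → InT N → (M *ₘ N) ≈ₘ (N *ₘ M))

  lincomb : ∀ {k} → Vector Carrier k → Vector Mat k → Mat
  lincomb {zero}  cs Ms = 0ₘ
  lincomb {suc k} cs Ms = (cs zero ·ₘ Ms zero) +ₘ lincomb (λ i → cs (suc i)) (λ i → Ms (suc i))

  LinIndep : ∀ {k} → Vector Mat k → Set (c ⊔ ℓ)
  LinIndep Ms = ∀ cs → lincomb cs Ms ≈ₘ 0ₘ → ∀ i → cs i ≈ 0#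

  IsBasis : ∀ {k} → (Mat → Set (c ⊔ ℓ)) → Vector Mat k → Set (c ⊔ ℓ)
  IsBasis S Ms = (∀ i → S (Ms i)) × LinIndep Ms
               × (∀ M → S M → ∃ λ cs → M ≈ₘ lincomb cs Ms)

  HasDim : (Mat → Set (c ⊔ ℓ)) → ℕ → Set (c ⊔ ℓ)
  HasDim S k = Σ (Vector Mat k) (IsBasis S)

{-# OPTIONS --safe #-}
module Submission where

-- A_g and E*_g are Kronecker products, over the coordinates a, of matrices α
-- and ε of the Terwilliger algebra of the complete graph on U_a with respect to
-- x_a, whose centre is spanned by the identity δ and ζ = ε₁α₁ε₁ + (u_a - 2)ε₀
-- (and ζ = 0 when u_a = 2).  For every set s of coordinates with u_a > 2, the
-- Kronecker product Z_s of ζ on s and δ off s is central, and it lies in 𝕋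
-- because each of its factors, placed at a single coordinate, does.  At the
-- pairs (y , q_t), where y and q_t avoid x and q_t differs from y exactly on t,
-- one has Z_s(y , q_t) = [s = t], so the Z_s are independent.  Conversely, a
-- central D ∈ 𝕋 vanishing at all these pairs vanishes: commuting with the E*_g
-- kills the entries between different shells around x; every element of 𝕋 is
-- invariant under the stabiliser of x, which moves each pair avoiding x onto
-- some (y , q_t); and commuting with ε₀α₁ placed at one coordinate removes,
-- one at a time, the coordinates where the row index meets x.

open import Defs
open import Level using (Level)
open import Data.Nat using (ℕ; _≤_; _^_)
open import Data.Fin using (Fin)

open import Algebra.Bundles using (CommutativeRing)
open import Data.Bool using (Bool; true; false; T; not; _∧_; _xor_; if_then_else_)
import Data.Bool.Properties as Bool
open import Data.Empty using (⊥-elim)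
open import Data.Fin as Fin using (zero; suc; remQuot; combine)
open import Data.Fin.Permutation
  using (Permutation′; _⟨$⟩ʳ_; _⟨$⟩ˡ_; inverseˡ; inverseʳ; transpose; _∘ₚ_; flip)
open import Data.Fin.Properties as Finₚ
  using (_≟_; 2↔Bool; combine-remQuot; remQuot-combine; ¬∀⟶∃¬; all?; any?)
open import Data.Fin.Subset using (Subset)
open import Data.List using (List; []; _∷_; _++_; map; concatMap; foldr; allFin)
import Data.List as List
open import Data.List.Membership.Propositional using (_∈_)
open import Data.List.Membership.Propositional.Properties using (∈-allFin)
open import Data.List.Relation.Unary.Any using (here; there)
open import Data.Nat as ℕ using (zero; suc; _<_; s≤s; z≤n)
import Data.Nat.Properties as ℕₚ
open import Data.Product using (_×_; _,_; ∃; proj₁; proj₂; map₁; uncurry)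
open import Data.Sum using (inj₁; inj₂)
open import Data.Unit using (tt)
open import Data.Vec as Vec using (Vec; []; _∷_; lookup)
open import Data.Vec.Functional using (Vector)
import Data.Vec.Properties as Vecₚ
open import Function using (_∘_; id; Inverse; case_of_)
open import Relation.Binary.Definitions using (tri<; tri≈; tri>)
open import Relation.Binary.PropositionalEquality as ≡ using (_≡_; _≢_)
open import Relation.Nullary using (Dec; does; yes; no; ¬_)
open import Relation.Nullary.Decidable using (dec-true; dec-false; _⊎-dec_)

-- Subsets of a Boolean predicate, enumerated by Fin (2 ^ countB P)

_⊆ᵇ_ : ∀ {n} → (Fin n → Bool) → (Fin n → Bool) → Set
t ⊆ᵇ P = ∀ a → T (t a) → T (P a)

module _ where
  open Inverse 2↔Bool using (to; from; strictlyInverseˡ; strictlyInverseʳ)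

  -- The exponent is countB unfolded once.
  popBit : ∀ b {k} → Fin (2 ^ ((if b then 1 else 0) ℕ.+ k)) → Bool × Fin (2 ^ k)
  popBit false i = false , i
  popBit true {k} i = map₁ to (remQuot (2 ^ k) i)

  popBit-⊆ : ∀ b {k} (i : Fin (2 ^ ((if b then 1 else 0) ℕ.+ k))) →
             T (proj₁ (popBit b i)) → T b
  popBit-⊆ false i ()
  popBit-⊆ true  i _ = tt

  popBit-injective : ∀ b {k} {i j : Fin (2 ^ ((if b then 1 else 0) ℕ.+ k))} →
                     popBit b i ≡ popBit b j → i ≡ j
  popBit-injective false eq = ≡.cong proj₂ eq
  popBit-injective true {k} {i} {j} eq = begin
    i                                        ≡⟨ combine-remQuot {2} (2 ^ k) i ⟨
    uncurry combine (remQuot {2} (2 ^ k) i)  ≡⟨ ≡.cong (uncurry combine) remQuot-≡ ⟩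
    uncurry combine (remQuot {2} (2 ^ k) j)  ≡⟨ combine-remQuot {2} (2 ^ k) j ⟩
    j                                        ∎
    where
    open ≡.≡-Reasoning
    from-to : ∀ r → map₁ from (map₁ to r) ≡ r
    from-to (b , r) = ≡.cong (_, r) (strictlyInverseʳ b)
    remQuot-≡ : remQuot (2 ^ k) i ≡ remQuot (2 ^ k) j
    remQuot-≡ = ≡.trans (≡.sym (from-to _)) (≡.trans (≡.cong (map₁ from) eq) (from-to _))

  popBit-surjective : ∀ b {k} c (j : Fin (2 ^ k)) → (T c → T b) →
                      ∃ λ i → popBit b {k} i ≡ (c , j)
  popBit-surjective false false j _   = j , ≡.refl
  popBit-surjective false true  j c⇒b = ⊥-elim (c⇒b tt)
  popBit-surjective true  c     j _   = combine (from c) j ,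
    ≡.trans (≡.cong (map₁ to) (remQuot-combine (from c) j)) (≡.cong (_, j) (strictlyInverseˡ c))

subset : ∀ {n} (P : Fin n → Bool) → Fin (2 ^ countB P) → Fin n → Bool
subset {suc n} P i zero    = proj₁ (popBit (P zero) i)
subset {suc n} P i (suc a) = subset (P ∘ suc) (proj₂ (popBit (P zero) i)) a

subset-⊆ : ∀ {n} (P : Fin n → Bool) i → subset P i ⊆ᵇ P
subset-⊆ {suc n} P i zero    = popBit-⊆ (P zero) i
subset-⊆ {suc n} P i (suc a) = subset-⊆ (P ∘ suc) _ a

subset-injective : ∀ {n} (P : Fin n → Bool) {i j} →
                   (∀ a → subset P i a ≡ subset P j a) → i ≡ j
subset-injective {zero}  P {zero} {zero} _ = ≡.refl
subset-injective {suc n} P eq = popBit-injective (P zero)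
  (≡.cong₂ _,_ (eq zero) (subset-injective (P ∘ suc) (eq ∘ suc)))

subset-surjective : ∀ {n} (P : Fin n → Bool) t → t ⊆ᵇ P →
                    ∃ λ i → ∀ a → subset P i a ≡ t a
subset-surjective {zero}  P t _   = zero , λ ()
subset-surjective {suc n} P t t⊆P
  with j , subset-j ← subset-surjective (P ∘ suc) (t ∘ suc) (t⊆P ∘ suc)
  with i , popBit-i ← popBit-surjective (P zero) (t zero) j (t⊆P zero)
  = i , λ where
      zero    → ≡.cong proj₁ popBit-i
      (suc a) → ≡.trans (≡.cong (λ r → subset (P ∘ suc) (proj₂ r) a) popBit-i) (subset-j a)

allB-cong : ∀ {n} {f g : Fin n → Bool} → (∀ a → f a ≡ g a) → allB f ≡ allB g
allB-cong {zero}  eq = ≡.refl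
allB-cong {suc n} eq = ≡.cong₂ _∧_ (eq zero) (allB-cong (eq ∘ suc))

allB-true : ∀ {n} {f : Fin n → Bool} → (∀ a → f a ≡ true) → allB f ≡ true
allB-true {zero}  all-true = ≡.refl
allB-true {suc n} all-true rewrite all-true zero = allB-true (all-true ∘ suc)

allB-false : ∀ {n} {f : Fin n → Bool} a → f a ≡ false → allB f ≡ false
allB-false         zero    fa≡false rewrite fa≡false = ≡.refl
allB-false {f = f} (suc a) fa≡false with f zero
... | true  = allB-false a fa≡false
... | false = ≡.refl

T-does⇒ : ∀ {A : Set} (A? : Dec A) → T (does A?) → A
T-does⇒ (yes a) _ = a

⇒T-does : ∀ {A : Set} (A? : Dec A) → A → T (does A?)
⇒T-does A? a rewrite dec-true A? a = tt

T-not-does⇒ : ∀ {A : Set} (A? : Dec A) → T (not (does A?)) → ¬ A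
T-not-does⇒ (no ¬a) _ = ¬a

does-≢ : ∀ {A B : Set} {A? : Dec A} {B? : Dec B} → ¬ A → B → does A? ≢ does B?
does-≢ {A? = A?} {B?} ¬a b rewrite dec-false A? ¬a | dec-true B? b = λ ()

xnor-not : ∀ a b → not (not a xor not b) ≡ does (a Bool.≟ b)
xnor-not true  true  = ≡.refl
xnor-not true  false = ≡.refl
xnor-not false true  = ≡.refl
xnor-not false false = ≡.refl

xnor-false : ∀ e → not (not e xor false) ≡ e
xnor-false true  = ≡.refl
xnor-false false = ≡.refl

xnor-true : ∀ e → not (not e xor true) ≡ not e
xnor-true true  = ≡.refl
xnor-true false = ≡.refl

does-≟-sym : ∀ {m} (i j : Fin m) → does (i ≟ j) ≡ does (j ≟ i)
does-≟-sym i j with i ≟ j | j ≟ i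
... | yes _   | yes _   = ≡.refl
... | no  _   | no  _   = ≡.refl
... | yes i≡j | no  j≢i = ⊥-elim (j≢i (≡.sym i≡j))
... | no  i≢j | yes j≡i = ⊥-elim (i≢j (≡.sym j≡i))

other : ∀ {m} → 2 ≤ m → Fin m → Fin m
other (s≤s (s≤s _)) zero    = suc zero
other (s≤s (s≤s _)) (suc _) = zero

other-≢ : ∀ {m} (2≤m : 2 ≤ m) i → i ≢ other 2≤m i
other-≢ (s≤s (s≤s _)) zero    ()
other-≢ (s≤s (s≤s _)) (suc _) ()

third : ∀ {m} → 3 ≤ m → Fin m → Fin m → Fin m
third (s≤s (s≤s (s≤s _))) (suc _)    (suc _)    = zero
third (s≤s (s≤s (s≤s _))) zero       (suc zero) = suc (suc zero)
third (s≤s (s≤s (s≤s _))) (suc zero) zero       = suc (suc zero)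
third (s≤s (s≤s (s≤s _))) _          _          = suc zero

third-≢ : ∀ {m} (3≤m : 3 ≤ m) i j → i ≢ third 3≤m i j × j ≢ third 3≤m i j
third-≢ (s≤s (s≤s (s≤s _))) (suc _)       (suc _)       = (λ ()) , (λ ())
third-≢ (s≤s (s≤s (s≤s _))) zero          (suc zero)    = (λ ()) , (λ ())
third-≢ (s≤s (s≤s (s≤s _))) (suc zero)    zero          = (λ ()) , (λ ())
third-≢ (s≤s (s≤s (s≤s _))) zero          zero          = (λ ()) , (λ ())
third-≢ (s≤s (s≤s (s≤s _))) zero          (suc (suc _)) = (λ ()) , (λ ())
third-≢ (s≤s (s≤s (s≤s _))) (suc (suc _)) zero          = (λ ()) , (λ ())

distinct⇒3≤ : ∀ {m} {i j k : Fin m} → i ≢ j → i ≢ k → j ≢ k → 3 ≤ m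
distinct⇒3≤ {suc (suc (suc _))} _ _ _ = s≤s (s≤s (s≤s z≤n))
distinct⇒3≤ {suc zero}       {zero}     {zero}                i≢j _   _   = ⊥-elim (i≢j ≡.refl)
distinct⇒3≤ {suc (suc zero)} {zero}     {zero}                i≢j _   _   = ⊥-elim (i≢j ≡.refl)
distinct⇒3≤ {suc (suc zero)} {suc zero} {suc zero}            i≢j _   _   = ⊥-elim (i≢j ≡.refl)
distinct⇒3≤ {suc (suc zero)} {zero}     {suc zero} {zero}     _   i≢k _   = ⊥-elim (i≢k ≡.refl)
distinct⇒3≤ {suc (suc zero)} {suc zero} {zero}     {suc zero} _   i≢k _   = ⊥-elim (i≢k ≡.refl)
distinct⇒3≤ {suc (suc zero)} {zero}     {suc zero} {suc zero} _   _   j≢k = ⊥-elim (j≢k ≡.refl)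
distinct⇒3≤ {suc (suc zero)} {suc zero} {zero}     {zero}     _   _   j≢k = ⊥-elim (j≢k ≡.refl)

⟨$⟩ʳ-injective : ∀ {m} (π : Permutation′ m) {i j} → π ⟨$⟩ʳ i ≡ π ⟨$⟩ʳ j → i ≡ j
⟨$⟩ʳ-injective π eq =
  ≡.trans (≡.sym (inverseˡ π)) (≡.trans (≡.cong (π ⟨$⟩ˡ_) eq) (inverseˡ π))

does-≟-permute : ∀ {m} (π : Permutation′ m) i j → does (π ⟨$⟩ʳ i ≟ π ⟨$⟩ʳ j) ≡ does (i ≟ j)
does-≟-permute π i j with i ≟ j
... | yes ≡.refl = dec-true (π ⟨$⟩ʳ i ≟ π ⟨$⟩ʳ i) ≡.refl
... | no  i≢j    = dec-false (π ⟨$⟩ʳ i ≟ π ⟨$⟩ʳ j) (i≢j ∘ ⟨$⟩ʳ-injective π)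

does-≟-inverse : ∀ {m} (π : Permutation′ m) i j → does (π ⟨$⟩ʳ i ≟ j) ≡ does (i ≟ π ⟨$⟩ˡ j)
does-≟-inverse π i j = ≡.trans (≡.cong (λ k → does (π ⟨$⟩ʳ i ≟ k)) (≡.sym (inverseʳ π)))
                               (does-≟-permute π i (π ⟨$⟩ˡ j))

module _ {m} (i j : Fin m) where

  transpose-fixes : ∀ {k} → k ≢ i → k ≢ j → transpose i j ⟨$⟩ʳ k ≡ k
  transpose-fixes {k} k≢i k≢j rewrite dec-false (k ≟ i) k≢i | dec-false (k ≟ j) k≢j = ≡.refl

  transpose-moves : transpose i j ⟨$⟩ʳ i ≡ j
  transpose-moves rewrite dec-true (i ≟ i) ≡.refl = ≡.refl

fixing-permutation : ∀ {m} {x0 i j i′ j′ : Fin m} →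
  x0 ≢ i → x0 ≢ j → x0 ≢ i′ → x0 ≢ j′ → (i ≡ j → i′ ≡ j′) → (i′ ≡ j′ → i ≡ j) →
  ∃ λ (π : Permutation′ m) → π ⟨$⟩ʳ x0 ≡ x0 × π ⟨$⟩ʳ i ≡ i′ × π ⟨$⟩ʳ j ≡ j′
fixing-permutation {x0 = x0} {i} {j} {i′} {j′} x0≢i x0≢j x0≢i′ x0≢j′ i≡j⇒ i′≡j′⇒ =
  τ₁ ∘ₚ τ₂ , τ₂-x0 , τ₂-i′ , transpose-moves j₁ j′
  where
  τ₁ = transpose i i′
  j₁ = τ₁ ⟨$⟩ʳ j
  τ₂ = transpose j₁ j′
  τ₁-x0 : τ₁ ⟨$⟩ʳ x0 ≡ x0
  τ₁-x0 = transpose-fixes i i′ x0≢i x0≢i′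
  τ₂-x0 : τ₂ ⟨$⟩ʳ (τ₁ ⟨$⟩ʳ x0) ≡ x0
  τ₂-x0 = ≡.trans (≡.cong (τ₂ ⟨$⟩ʳ_) τ₁-x0) (transpose-fixes j₁ j′
    (λ x0≡j₁ → x0≢j (⟨$⟩ʳ-injective τ₁ (≡.trans τ₁-x0 x0≡j₁))) x0≢j′)
  τ₂-i′ : τ₂ ⟨$⟩ʳ (τ₁ ⟨$⟩ʳ i) ≡ i′
  τ₂-i′ rewrite transpose-moves i i′ with i ≟ j
  ... | yes i≡j = ≡.trans (≡.cong (τ₂ ⟨$⟩ʳ_) i′≡j₁)
                          (≡.trans (transpose-moves j₁ j′) (≡.sym (i≡j⇒ i≡j)))
    where i′≡j₁ = ≡.trans (≡.sym (transpose-moves i i′)) (≡.cong (τ₁ ⟨$⟩ʳ_) i≡j)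
  ... | no  i≢j = transpose-fixes j₁ j′
    (λ i′≡j₁ → i≢j (⟨$⟩ʳ-injective τ₁ (≡.trans (transpose-moves i i′) i′≡j₁)))
    (λ i′≡j′ → i≢j (i′≡j′⇒ i′≡j′))

_≗ₚ_ : ∀ {n} {u : Fin n → ℕ} → Point u → Point u → Set
p ≗ₚ q = ∀ a → p a ≡ q a

_∷ₚ_ : ∀ {n} {u : Fin (suc n) → ℕ} → Fin (u zero) → Point (u ∘ suc) → Point u
(i ∷ₚ p) zero    = i
(i ∷ₚ p) (suc a) = p a

∷ₚ-cong : ∀ {n} {u : Fin (suc n) → ℕ} (i : Fin (u zero)) {p q : Point (u ∘ suc)} →
          p ≗ₚ q → _≗ₚ_ {u = u} (i ∷ₚ p) (i ∷ₚ q)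
∷ₚ-cong i p≗q zero    = ≡.refl
∷ₚ-cong i p≗q (suc a) = p≗q a

∷ₚ-η : ∀ {n} {u : Fin (suc n) → ℕ} (p : Point u) → _≗ₚ_ {u = u} (p zero ∷ₚ (p ∘ suc)) p
∷ₚ-η p zero    = ≡.refl
∷ₚ-η p (suc a) = ≡.refl

==ₚ-sym : ∀ {n} {u : Fin n → ℕ} (p q : Point u) → (p ==ₚ q) ≡ (q ==ₚ p)
==ₚ-sym p q = allB-cong (λ a → does-≟-sym (p a) (q a))

==ₚ-cong : ∀ {n} {u : Fin n → ℕ} {p p′ q q′ : Point u} → p ≗ₚ p′ → q ≗ₚ q′ →
           (p ==ₚ q) ≡ (p′ ==ₚ q′)
==ₚ-cong p≗p′ q≗q′ = allB-cong (λ a → ≡.cong₂ (λ i j → does (i ≟ j)) (p≗p′ a) (q≗q′ a))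

inR-cong : ∀ {n} {u : Fin n → ℕ} g {p p′ q q′ : Point u} → p ≗ₚ p′ → q ≗ₚ q′ →
           inR g p q ≡ inR g p′ q′
inR-cong g p≗p′ q≗q′ = allB-cong (λ a →
  ≡.cong₂ (λ i j → not (not (does (i ≟ j)) xor lookup g a)) (p≗p′ a) (q≗q′ a))

_·ₚ_ : ∀ {n} {u : Fin n → ℕ} → ((a : Fin n) → Permutation′ (u a)) → Point u → Point u
(π ·ₚ p) a = π a ⟨$⟩ʳ p a

==ₚ-permute : ∀ {n} {u : Fin n → ℕ} (π : (a : Fin n) → Permutation′ (u a)) p q →
              ((π ·ₚ p) ==ₚ (π ·ₚ q)) ≡ (p ==ₚ q)
==ₚ-permute π p q = allB-cong (λ a → does-≟-permute (π a) (p a) (q a))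

==ₚ-inverse : ∀ {n} {u : Fin n → ℕ} (π : (a : Fin n) → Permutation′ (u a)) p q →
              ((π ·ₚ p) ==ₚ q) ≡ (p ==ₚ ((λ a → flip (π a)) ·ₚ q))
==ₚ-inverse π p q = allB-cong (λ a → does-≟-inverse (π a) (p a) (q a))

inR-permute : ∀ {n} {u : Fin n → ℕ} g (π : (a : Fin n) → Permutation′ (u a)) p q →
              inR g (π ·ₚ p) (π ·ₚ q) ≡ inR g p q
inR-permute g π p q = allB-cong (λ a →
  ≡.cong (λ e → not (not e xor lookup g a)) (does-≟-permute (π a) (p a) (q a)))

module Sums {c ℓ} (R : CommutativeRing c ℓ) where
  open CommutativeRing R hiding (zero)
  open import Relation.Binary.Reasoning.Setoid setoid
  open import Algebra.Properties.Semiring.Sum semiring public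
    using (sum; sum-cong-≋; sum-replicate-zero; ∑-distrib-+; *-distribˡ-sum; *-distribʳ-sum)
  open import Algebra.Properties.CommutativeMonoid.Sum *-commutativeMonoid public
    using () renaming (sum to prod; sum-cong-≋ to prod-cong; ∑-distrib-+ to prod-distrib-*;
                       sum-replicate-zero to prod-replicate-one)
  open import Algebra.Properties.CommutativeSemigroup +-commutativeSemigroup
    using () renaming (interchange to +-interchange)
  open import Algebra.Properties.CommutativeSemigroup *-commutativeSemigroup
    using (x∙yz≈y∙xz)
  open import Algebra.Properties.Ring ring using (-‿+-comm; -0#≈0#; [y-z]x≈yx-zx)

  𝔹 : Bool → Carrier
  𝔹 b = if b then 1# else 0#

  𝔹-∧ : ∀ a b → 𝔹 (a ∧ b) ≈ 𝔹 a * 𝔹 b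
  𝔹-∧ true  b = sym (*-identityˡ _)
  𝔹-∧ false b = sym (zeroˡ _)

  𝔹-allB : ∀ {n} (f : Fin n → Bool) → 𝔹 (allB f) ≈ prod (𝔹 ∘ f)
  𝔹-allB {zero}  f = refl
  𝔹-allB {suc n} f = trans (𝔹-∧ (f zero) _) (*-congˡ (𝔹-allB (f ∘ suc)))

  𝔹-not : ∀ b → 𝔹 (not b) ≈ 1# - 𝔹 b
  𝔹-not true  = sym (-‿inverseʳ 1#)
  𝔹-not false = sym (trans (+-congˡ -0#≈0#) (+-identityʳ 1#))

  [1-x]*y≈y-xy : ∀ x y → (1# - x) * y ≈ y - x * y
  [1-x]*y≈y-xy x y = trans ([y-z]x≈yx-zx y 1# x) (+-congʳ (*-identityˡ y))

  sum-zero : ∀ {m} (f : Fin m → Carrier) → (∀ i → f i ≈ 0#) → sum f ≈ 0#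
  sum-zero {m} f f≈0 = trans (sum-cong-≋ f≈0) (sum-replicate-zero m)

  sum-δˡ : ∀ {m} (j : Fin m) (f : Fin m → Carrier) → sum (λ i → 𝔹 (does (j ≟ i)) * f i) ≈ f j
  sum-δˡ {suc m} zero f = begin
    1# * f zero + sum (λ i → 0# * f (suc i))
      ≈⟨ +-cong (*-identityˡ _) (sum-zero (λ i → 0# * f (suc i)) (λ i → zeroˡ _)) ⟩
    f zero + 0#
      ≈⟨ +-identityʳ _ ⟩
    f zero ∎
  sum-δˡ {suc m} (suc j) f = trans (+-cong (zeroˡ _) (sum-δˡ j (f ∘ suc))) (+-identityˡ _)

  sum-δʳ : ∀ {m} (j : Fin m) (f : Fin m → Carrier) → sum (λ i → f i * 𝔹 (does (i ≟ j))) ≈ f j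
  sum-δʳ j f = trans (sum-cong-≋ λ i →
                        trans (*-comm _ _) (*-congʳ (reflexive (≡.cong 𝔹 (does-≟-sym i j)))))
                     (sum-δˡ j f)

  sum-neg : ∀ {m} (f : Fin m → Carrier) → sum (λ i → - f i) ≈ - sum f
  sum-neg {zero}  f = sym -0#≈0#
  sum-neg {suc m} f = trans (+-congˡ (sum-neg (f ∘ suc))) (-‿+-comm _ _)

  sum-distrib-− : ∀ {m} (f g : Fin m → Carrier) → sum (λ i → f i - g i) ≈ sum f - sum g
  sum-distrib-− f g = trans (∑-distrib-+ f (λ i → - g i)) (+-congˡ (sum-neg g))

  prod-zero : ∀ {m} (f : Fin m → Carrier) a → f a ≈ 0# → prod f ≈ 0#
  prod-zero f zero    fa≈0 = trans (*-congʳ fa≈0) (zeroˡ _)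
  prod-zero f (suc a) fa≈0 = trans (*-congˡ (prod-zero (f ∘ suc) a fa≈0)) (zeroʳ _)

  prod-one : ∀ {m} (f : Fin m → Carrier) → (∀ a → f a ≈ 1#) → prod f ≈ 1#
  prod-one {m} f f≈1 = trans (prod-cong f≈1) (prod-replicate-one m)

  prod-linear : ∀ {m} (b : Fin m) (f g h : Fin m → Carrier) k → f b ≈ g b + k * h b →
                (∀ a → a ≢ b → f a ≈ g a) → (∀ a → a ≢ b → f a ≈ h a) →
                prod f ≈ prod g + k * prod h
  prod-linear zero f g h k fb g≈ h≈ = begin
    f zero * prod (f ∘ suc)
      ≈⟨ *-cong fb (prod-cong (λ a → g≈ (suc a) λ ())) ⟩
    (g zero + k * h zero) * prod (g ∘ suc)
      ≈⟨ distribʳ _ _ _ ⟩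
    g zero * prod (g ∘ suc) + k * h zero * prod (g ∘ suc)
      ≈⟨ +-congˡ (trans (*-assoc _ _ _) (*-congˡ (*-congˡ (prod-cong (λ a →
           trans (sym (g≈ (suc a) λ ())) (h≈ (suc a) λ ())))))) ⟩
    g zero * prod (g ∘ suc) + k * (h zero * prod (h ∘ suc)) ∎
  prod-linear (suc b) f g h k fb g≈ h≈ = begin
    f zero * prod (f ∘ suc)
      ≈⟨ *-congˡ (prod-linear b (f ∘ suc) (g ∘ suc) (h ∘ suc) k fb
                   (λ a a≢b → g≈ (suc a) (a≢b ∘ Finₚ.suc-injective))
                   (λ a a≢b → h≈ (suc a) (a≢b ∘ Finₚ.suc-injective))) ⟩
    f zero * (prod (g ∘ suc) + k * prod (h ∘ suc))
      ≈⟨ distribˡ _ _ _ ⟩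
    f zero * prod (g ∘ suc) + f zero * (k * prod (h ∘ suc))
      ≈⟨ +-cong (*-congʳ (g≈ zero λ ())) (trans (x∙yz≈y∙xz _ _ _) (*-congˡ (*-congʳ (h≈ zero λ ())))) ⟩
    g zero * prod (g ∘ suc) + k * (h zero * prod (h ∘ suc)) ∎

  cube : ∀ {m} → (Vec Bool m → Carrier) → Carrier
  cube {zero}  f = f []
  cube {suc m} f = cube (λ v → f (false ∷ v)) + cube (λ v → f (true ∷ v))

  cube-cong : ∀ {m} {f g : Vec Bool m → Carrier} → (∀ v → f v ≈ g v) → cube f ≈ cube g
  cube-cong {zero}  f≈g = f≈g []
  cube-cong {suc m} f≈g =
    +-cong (cube-cong (λ v → f≈g (false ∷ v))) (cube-cong (λ v → f≈g (true ∷ v)))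

  *-distribˡ-cube : ∀ {m} k (f : Vec Bool m → Carrier) → k * cube f ≈ cube (λ v → k * f v)
  *-distribˡ-cube {zero}  k f = refl
  *-distribˡ-cube {suc m} k f = trans (distribˡ k _ _)
    (+-cong (*-distribˡ-cube k (λ v → f (false ∷ v))) (*-distribˡ-cube k (λ v → f (true ∷ v))))

  cube-prod : ∀ {m} (h : Fin m → Bool → Carrier) →
              cube (λ v → prod (λ a → h a (lookup v a))) ≈ prod (λ a → h a false + h a true)
  cube-prod {zero}  h = refl
  cube-prod {suc m} h = begin
    cube (λ v → h zero false * P v) + cube (λ v → h zero true * P v)
      ≈⟨ +-cong (*-distribˡ-cube (h zero false) P) (*-distribˡ-cube (h zero true) P) ⟨
    h zero false * cube P + h zero true * cube P
      ≈⟨ distribʳ _ _ _ ⟨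
    (h zero false + h zero true) * cube P
      ≈⟨ *-congˡ (cube-prod (h ∘ suc)) ⟩
    (h zero false + h zero true) * prod (λ a → h (suc a) false + h (suc a) true) ∎
    where
    P : Vec Bool m → Carrier
    P v = prod (λ a → h (suc a) (lookup v a))

  private variable A B : Set

  lsum : List A → (A → Carrier) → Carrier
  lsum xs f = foldr (λ w s → f w + s) 0# xs

  lsum-cong : ∀ (xs : List A) {f g : A → Carrier} → (∀ w → f w ≈ g w) → lsum xs f ≈ lsum xs g
  lsum-cong []       f≈g = refl
  lsum-cong (w ∷ xs) f≈g = +-cong (f≈g w) (lsum-cong xs f≈g)

  lsum-zero : ∀ (xs : List A) (f : A → Carrier) → (∀ w → f w ≈ 0#) → lsum xs f ≈ 0#
  lsum-zero []       f f≈0 = refl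
  lsum-zero (w ∷ xs) f f≈0 = trans (+-cong (f≈0 w) (lsum-zero xs f f≈0)) (+-identityʳ 0#)

  lsum-distrib-+ : ∀ (xs : List A) (f g : A → Carrier) →
                   lsum xs (λ w → f w + g w) ≈ lsum xs f + lsum xs g
  lsum-distrib-+ []       f g = sym (+-identityʳ 0#)
  lsum-distrib-+ (w ∷ xs) f g =
    trans (+-congˡ (lsum-distrib-+ xs f g)) (+-interchange _ _ _ _)

  *-distribˡ-lsum : ∀ (xs : List A) k (f : A → Carrier) → k * lsum xs f ≈ lsum xs (λ w → k * f w)
  *-distribˡ-lsum []       k f = zeroʳ k
  *-distribˡ-lsum (w ∷ xs) k f = trans (distribˡ k _ _) (+-congˡ (*-distribˡ-lsum xs k f))

  *-distribʳ-lsum : ∀ (xs : List A) k (f : A → Carrier) → lsum xs f * k ≈ lsum xs (λ w → f w * k)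
  *-distribʳ-lsum []       k f = zeroˡ k
  *-distribʳ-lsum (w ∷ xs) k f = trans (distribʳ k _ _) (+-congˡ (*-distribʳ-lsum xs k f))

  lsum-++ : ∀ (xs ys : List A) (f : A → Carrier) → lsum (xs ++ ys) f ≈ lsum xs f + lsum ys f
  lsum-++ []       ys f = sym (+-identityˡ _)
  lsum-++ (w ∷ xs) ys f = trans (+-congˡ (lsum-++ xs ys f)) (sym (+-assoc _ _ _))

  lsum-tabulate : ∀ {m} (g : Fin m → A) (f : A → Carrier) → lsum (List.tabulate g) f ≈ sum (f ∘ g)
  lsum-tabulate {m = zero}  g f = refl
  lsum-tabulate {m = suc m} g f = +-congˡ (lsum-tabulate (g ∘ suc) f)

  lsum-map : ∀ (h : A → B) (xs : List A) (f : B → Carrier) → lsum (map h xs) f ≈ lsum xs (f ∘ h)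
  lsum-map h []       f = refl
  lsum-map h (w ∷ xs) f = +-congˡ (lsum-map h xs f)

  lsum-concatMap : ∀ (h : A → List B) (xs : List A) (f : B → Carrier) →
                   lsum (concatMap h xs) f ≈ lsum xs (λ w → lsum (h w) f)
  lsum-concatMap h []       f = refl
  lsum-concatMap h (w ∷ xs) f = trans (lsum-++ (h w) _ f) (+-congˡ (lsum-concatMap h xs f))

  lsum-comm : ∀ (xs : List A) (ys : List B) (f : A → B → Carrier) →
              lsum xs (λ a → lsum ys (f a)) ≈ lsum ys (λ b → lsum xs (λ a → f a b))
  lsum-comm []       ys f = sym (lsum-zero ys _ (λ _ → refl))
  lsum-comm (w ∷ xs) ys f =
    trans (+-congˡ (lsum-comm xs ys f)) (sym (lsum-distrib-+ ys (f w) _))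

  Σₚ : ∀ {n} (u : Fin n → ℕ) → (Point u → Carrier) → Carrier
  Σₚ u = lsum (allPoints u)

  Extensional : ∀ {n} {u : Fin n → ℕ} → (Point u → Carrier) → Set ℓ
  Extensional f = ∀ {p q} → p ≗ₚ q → f p ≈ f q

  private
    -- The constructor of points used by allPoints is local to its definition,
    -- so it is obtained here by unification.
    Σₚ-unfold : ∀ {n} (u : Fin (suc n) → ℕ) →
      ∃ λ (cons : Fin (u zero) → Point (u ∘ suc) → Point u) →
        (∀ i p → (i ∷ₚ p) ≗ₚ cons i p) ×
        (∀ f → Σₚ u f ≈ sum (λ i → Σₚ (u ∘ suc) (f ∘ cons i)))
    Σₚ-unfold u = _ , (λ i p → λ { zero → ≡.refl ; (suc a) → ≡.refl }) , λ f →
      trans (lsum-concatMap {B = Point u} _ (allFin (u zero)) f)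
            (trans (lsum-tabulate {m = u zero} id _)
                   (sum-cong-≋ {u zero} λ i → lsum-map _ (allPoints (u ∘ suc)) f))

  Σₚ-cons : ∀ {n} {u : Fin (suc n) → ℕ} (f : Point u → Carrier) → Extensional f →
            Σₚ u f ≈ sum (λ i → Σₚ (u ∘ suc) (λ p → f (i ∷ₚ p)))
  Σₚ-cons {u = u} f ext with cons , ∷ₚ≗cons , unfold ← Σₚ-unfold u =
    trans (unfold f) (sum-cong-≋ λ i → lsum-cong (allPoints (u ∘ suc)) λ p →
                                         ext (λ a → ≡.sym (∷ₚ≗cons i p a)))

  Σₚ-prod : ∀ {n} (u : Fin n → ℕ) (h : (a : Fin n) → Fin (u a) → Carrier) →
            Σₚ u (λ w → prod (λ a → h a (w a))) ≈ prod (λ a → sum (h a))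
  Σₚ-prod {zero}  u h = +-identityʳ 1#
  Σₚ-prod {suc n} u h = begin
    Σₚ u (λ w → prod (λ a → h a (w a)))
      ≈⟨ Σₚ-cons _ (λ p≗q → prod-cong (λ a → reflexive (≡.cong (h a) (p≗q a)))) ⟩
    sum (λ i → Σₚ (u ∘ suc) (λ p → h zero i * prod (λ a → h (suc a) (p a))))
      ≈⟨ sum-cong-≋ {u zero} (λ i → sym (*-distribˡ-lsum (allPoints (u ∘ suc)) (h zero i) _)) ⟩
    sum (λ i → h zero i * Σₚ (u ∘ suc) (λ p → prod (λ a → h (suc a) (p a))))
      ≈⟨ sum-cong-≋ {u zero} (λ i → *-congˡ (Σₚ-prod (u ∘ suc) (h ∘ suc))) ⟩
    sum (λ i → h zero i * prod (λ a → sum (h (suc a))))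
      ≈⟨ *-distribʳ-sum _ (h zero) ⟨
    prod (λ a → sum (h a)) ∎

  Σₚ-δ : ∀ {n} {u : Fin n → ℕ} (r : Point u) (f : Point u → Carrier) → Extensional f →
         Σₚ u (λ w → 𝔹 (r ==ₚ w) * f w) ≈ f r
  Σₚ-δ {zero}  r f ext = trans (+-identityʳ _) (trans (*-identityˡ _) (ext (λ ())))
  Σₚ-δ {suc n} {u} r f ext = begin
    Σₚ u (λ w → 𝔹 (r ==ₚ w) * f w)
      ≈⟨ Σₚ-cons _ (λ p≗q → *-cong (reflexive (≡.cong 𝔹 (==ₚ-cong {p = r} (λ _ → ≡.refl) p≗q)))
                                     (ext p≗q)) ⟩
    sum (λ i → Σₚ (u ∘ suc) (λ p → 𝔹 (does (r zero ≟ i) ∧ ((r ∘ suc) ==ₚ p)) * f (i ∷ₚ p)))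
      ≈⟨ sum-cong-≋ {u zero} (λ i →
           trans (lsum-cong rest (λ p → trans (*-congʳ (𝔹-∧ _ _)) (*-assoc _ _ _)))
                 (sym (*-distribˡ-lsum rest _ _))) ⟩
    sum (λ i → 𝔹 (does (r zero ≟ i)) * Σₚ (u ∘ suc) (λ p → 𝔹 ((r ∘ suc) ==ₚ p) * f (i ∷ₚ p)))
      ≈⟨ sum-cong-≋ {u zero} (λ i → *-congˡ (Σₚ-δ (r ∘ suc) (λ p → f (i ∷ₚ p))
                                                   (λ p≗q → ext (∷ₚ-cong {u = u} i p≗q)))) ⟩
    sum (λ i → 𝔹 (does (r zero ≟ i)) * f (i ∷ₚ (r ∘ suc)))
      ≈⟨ sum-δˡ (r zero) _ ⟩
    f (r zero ∷ₚ (r ∘ suc))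
      ≈⟨ ext (∷ₚ-η {u = u} r) ⟩
    f r ∎
    where rest = allPoints (u ∘ suc)

  Σₚ-δʳ : ∀ {n} {u : Fin n → ℕ} (r : Point u) (f : Point u → Carrier) → Extensional f →
          Σₚ u (λ w → f w * 𝔹 (w ==ₚ r)) ≈ f r
  Σₚ-δʳ r f ext = trans (lsum-cong (allPoints _) (λ w →
    trans (*-comm _ _) (*-congʳ (reflexive (≡.cong 𝔹 (==ₚ-sym w r)))))) (Σₚ-δ r f ext)

  Σₚ-permute : ∀ {n} {u : Fin n → ℕ} (π : (a : Fin n) → Permutation′ (u a)) (f : Point u → Carrier) →
               Extensional f → Σₚ u (λ w → f (π ·ₚ w)) ≈ Σₚ u f
  Σₚ-permute {u = u} π f ext = begin
    Σₚ u (λ w → f (π ·ₚ w))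
      ≈⟨ lsum-cong points (λ w → Σₚ-δ (π ·ₚ w) f ext) ⟨
    Σₚ u (λ w → Σₚ u (λ v → 𝔹 ((π ·ₚ w) ==ₚ v) * f v))
      ≈⟨ lsum-comm points points _ ⟩
    Σₚ u (λ v → Σₚ u (λ w → 𝔹 ((π ·ₚ w) ==ₚ v) * f v))
      ≈⟨ lsum-cong points (λ v → trans (lsum-cong points (λ w →
           trans (*-comm _ _) (*-congˡ (reflexive (≡.cong 𝔹 (==ₚ-inverse π w v))))))
           (Σₚ-δʳ ((λ a → flip (π a)) ·ₚ v) (λ _ → f v) (λ _ → refl))) ⟩
    Σₚ u f ∎
    where points = allPoints u

module SquareMatrices {c ℓ} (R : CommutativeRing c ℓ) where
  open CommutativeRing R hiding (zero)
  open Sums R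

  SqMat : ℕ → Set c
  SqMat m = Fin m → Fin m → Carrier

  infix 4 _≋_
  _≋_ : ∀ {m} → SqMat m → SqMat m → Set ℓ
  φ ≋ ψ = ∀ i j → φ i j ≈ ψ i j

  infixl 7 _⊙_
  _⊙_ : ∀ {m} → SqMat m → SqMat m → SqMat m
  (φ ⊙ ψ) i j = sum (λ k → φ i k * ψ k j)

  δ : ∀ {m} → SqMat m
  δ i j = 𝔹 (does (i ≟ j))

  δ-refl : ∀ {m} (i : Fin m) → δ i i ≡ 1#
  δ-refl i = ≡.cong 𝔹 (dec-true (i ≟ i) ≡.refl)

  δ-≢ : ∀ {m} {i j : Fin m} → i ≢ j → δ i j ≡ 0#
  δ-≢ {i = i} {j} i≢j = ≡.cong 𝔹 (dec-false (i ≟ j) i≢j)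

  δ-transport : ∀ {m} (i j : Fin m) (f : Fin m → Carrier) → δ i j * f i ≈ δ i j * f j
  δ-transport i j f with i ≟ j
  ... | yes ≡.refl = refl
  ... | no  _      = trans (zeroˡ _) (sym (zeroˡ _))

  ⊙-cong : ∀ {m} {φ φ′ ψ ψ′ : SqMat m} → φ ≋ φ′ → ψ ≋ ψ′ → φ ⊙ ψ ≋ φ′ ⊙ ψ′
  ⊙-cong φ≋φ′ ψ≋ψ′ i j = sum-cong-≋ (λ k → *-cong (φ≋φ′ i k) (ψ≋ψ′ k j))

  δ-⊙ : ∀ {m} (ψ : SqMat m) → δ ⊙ ψ ≋ ψ
  δ-⊙ ψ i j = sum-δˡ i (λ k → ψ k j)

  ⊙-δ : ∀ {m} (ψ : SqMat m) → ψ ⊙ δ ≋ ψ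
  ⊙-δ ψ i j = sum-δʳ j (ψ i)

  δ-comm : ∀ {m} (ψ : SqMat m) → δ ⊙ ψ ≋ ψ ⊙ δ
  δ-comm ψ i j = trans (δ-⊙ ψ i j) (sym (⊙-δ ψ i j))

-- The Terwilliger algebra of the complete graph on Fin m with respect to x0

-- α b and ε b are the factors of A_g and E*_g at a coordinate, b recording
-- whether the coordinate lies in ℙ(g); shell false and shell true are the
-- indicators of {x0} and of its complement.  With μ = m - 2, the matrix ζ is
-- ε₁ α₁ ε₁ + μ ε₀, which together with δ spans the centre of this algebra.
module CompleteGraph {c ℓ} (R : CommutativeRing c ℓ) {m} (x0 : Fin m) where
  open CommutativeRing R hiding (zero)
  open Sums R
  open SquareMatrices R
  open import Relation.Binary.Reasoning.Setoid setoid
  open import Algebra.Properties.CommutativeSemigroup *-commutativeSemigroup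
    using (x∙yz≈z∙yx)

  α : Bool → SqMat m
  α b i j = 𝔹 (not (not (does (i ≟ j)) xor b))

  shell : Bool → Fin m → Carrier
  shell b i = 𝔹 (not (not (does (x0 ≟ i)) xor b))

  ε : Bool → SqMat m
  ε b i j = δ i j * shell b i

  μ : Carrier
  μ = sum (shell true) - 1#

  ζ : SqMat m
  ζ i j = shell true i * (α true i j * shell true j) + μ * ε false i j

  γ : SqMat m
  γ = ε false ⊙ α true

  α-false : α false ≋ δ
  α-false i j = reflexive (≡.cong 𝔹 (xnor-false (does (i ≟ j))))

  α-true : ∀ i j → α true i j ≡ 𝔹 (not (does (i ≟ j)))
  α-true i j = ≡.cong 𝔹 (xnor-true (does (i ≟ j)))

  α-true-refl : ∀ i → α true i i ≡ 0#
  α-true-refl i = ≡.trans (α-true i i) (≡.cong (𝔹 ∘ not) (dec-true (i ≟ i) ≡.refl))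

  α-true-≢ : ∀ {i j} → i ≢ j → α true i j ≡ 1#
  α-true-≢ {i} {j} i≢j = ≡.trans (α-true i j) (≡.cong (𝔹 ∘ not) (dec-false (i ≟ j) i≢j))

  α-sym : ∀ b i j → α b i j ≡ α b j i
  α-sym b i j = ≡.cong (λ e → 𝔹 (not (not e xor b))) (does-≟-sym i j)

  sum-α-true : ∀ i (f : Fin m → Carrier) → sum (λ k → α true i k * f k) ≈ sum f - f i
  sum-α-true i f = begin
    sum (λ k → α true i k * f k)
      ≈⟨ sum-cong-≋ {m} (λ k → trans (*-congʳ (trans (reflexive (α-true i k)) (𝔹-not _)))
                                     ([1-x]*y≈y-xy _ _)) ⟩
    sum (λ k → f k - δ i k * f k)    ≈⟨ sum-distrib-− f _ ⟩
    sum f - sum (λ k → δ i k * f k)  ≈⟨ +-congˡ (-‿cong (sum-δˡ i f)) ⟩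
    sum f - f i                      ∎

  α-true-⊙ : ∀ (ψ : SqMat m) i j → (α true ⊙ ψ) i j ≈ sum (λ k → ψ k j) - ψ i j
  α-true-⊙ ψ i j = sum-α-true i (λ k → ψ k j)

  ⊙-α-true : ∀ (ψ : SqMat m) i j → (ψ ⊙ α true) i j ≈ sum (ψ i) - ψ i j
  ⊙-α-true ψ i j =
    trans (sum-cong-≋ {m} (λ k → trans (*-comm _ _) (*-congʳ (reflexive (α-sym true k j)))))
          (sum-α-true j (ψ i))

  ε-⊙ : ∀ b (ψ : SqMat m) i j → (ε b ⊙ ψ) i j ≈ shell b i * ψ i j
  ε-⊙ b ψ i j = trans (sum-cong-≋ {m} (λ k → *-assoc _ _ _)) (sum-δˡ i (λ k → shell b i * ψ k j))

  ⊙-ε : ∀ b (ψ : SqMat m) i j → (ψ ⊙ ε b) i j ≈ ψ i j * shell b j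
  ⊙-ε b ψ i j =
    trans (sum-cong-≋ {m} (λ k → trans (*-congˡ (*-comm _ _)) (sym (*-assoc _ _ _))))
          (sum-δʳ j (λ k → ψ i k * shell b k))

  ε-sum : ∀ i j → ε false i j + ε true i j ≈ δ i j
  ε-sum i j =
    trans (sym (distribˡ _ _ _)) (trans (*-congˡ (shells (does (x0 ≟ i)))) (*-identityʳ _))
    where
    shells : ∀ e → 𝔹 (not (not e xor false)) + 𝔹 (not (not e xor true)) ≈ 1#
    shells true  = +-identityʳ 1#
    shells false = +-identityˡ 1#

  ε-select : ∀ t i j →
             𝔹 (does (false Bool.≟ t)) * ε false i j + 𝔹 (does (true Bool.≟ t)) * ε true i j ≈ ε t i j
  ε-select false i j = trans (+-cong (*-identityˡ _) (zeroˡ _)) (+-identityʳ _)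
  ε-select true  i j = trans (+-cong (zeroˡ _) (*-identityˡ _)) (+-identityˡ _)

  ζ-decomposition : ∀ i j → ζ i j ≈ (ε true ⊙ (α true ⊙ ε true)) i j + μ * ε false i j
  ζ-decomposition i j =
    +-congʳ (sym (trans (ε-⊙ true (α true ⊙ ε true) i j) (*-congˡ (⊙-ε true (α true) i j))))

  ζ-sym : ∀ i j → ζ i j ≈ ζ j i
  ζ-sym i j = +-cong (trans (*-congˡ (*-congʳ (reflexive (α-sym true i j)))) (x∙yz≈z∙yx _ _ _))
                     (*-congˡ (trans (δ-transport i j (shell false))
                                     (*-congʳ (reflexive (≡.cong 𝔹 (does-≟-sym i j))))))

  ζ-row-sum : ∀ i → sum (ζ i) ≈ μ
  ζ-row-sum i = begin
    sum (ζ i)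
      ≈⟨ ∑-distrib-+ (λ k → shell true i * (α true i k * shell true k)) (λ k → μ * ε false i k) ⟩
    sum (λ k → shell true i * (α true i k * shell true k)) + sum (λ k → μ * (δ i k * shell false i))
      ≈⟨ +-cong (*-distribˡ-sum (shell true i) (λ k → α true i k * shell true k))
                (*-distribˡ-sum μ (λ k → δ i k * shell false i)) ⟨
    shell true i * sum (λ k → α true i k * shell true k) + μ * sum (λ k → δ i k * shell false i)
      ≈⟨ +-cong (*-congˡ (sum-α-true i (shell true))) (*-congˡ (sum-δˡ i (λ _ → shell false i))) ⟩
    shell true i * (sum (shell true) - shell true i) + μ * shell false i
      ≈⟨ by-shell (does (x0 ≟ i)) ⟩
    μ ∎
    where
    by-shell : ∀ e → let s = λ b → 𝔹 (not (not e xor b)) in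
               s true * (sum (shell true) - s true) + μ * s false ≈ μ
    by-shell true  = trans (+-cong (zeroˡ _) (*-identityʳ μ)) (+-identityˡ μ)
    by-shell false = trans (+-cong (*-identityˡ μ) (zeroʳ μ)) (+-identityʳ μ)

  ζ-col-sum : ∀ j → sum (λ k → ζ k j) ≈ μ
  ζ-col-sum j = trans (sum-cong-≋ {m} (λ k → ζ-sym k j)) (ζ-row-sum j)

  ζ-α-comm : ∀ b → ζ ⊙ α b ≋ α b ⊙ ζ
  ζ-α-comm false i j = begin
    (ζ ⊙ α false) i j  ≈⟨ ⊙-cong {φ = ζ} (λ _ _ → refl) α-false i j ⟩
    (ζ ⊙ δ) i j        ≈⟨ δ-comm ζ i j ⟨
    (δ ⊙ ζ) i j        ≈⟨ ⊙-cong {ψ = ζ} α-false (λ _ _ → refl) i j ⟨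
    (α false ⊙ ζ) i j  ∎
  ζ-α-comm true i j = begin
    (ζ ⊙ α true) i j           ≈⟨ ⊙-α-true ζ i j ⟩
    sum (ζ i) - ζ i j          ≈⟨ +-congʳ (trans (ζ-row-sum i) (sym (ζ-col-sum j))) ⟩
    sum (λ k → ζ k j) - ζ i j  ≈⟨ α-true-⊙ ζ i j ⟨
    (α true ⊙ ζ) i j           ∎

  ζ-across : ∀ {i j} → does (x0 ≟ i) ≢ does (x0 ≟ j) → ζ i j ≈ 0#
  ζ-across {i} {j} differ with x0 ≟ i | x0 ≟ j
  ... | yes _      | yes _      = ⊥-elim (differ ≡.refl)
  ... | no  _      | no  _      = ⊥-elim (differ ≡.refl)
  ... | yes ≡.refl | no  x0≢j   = begin
    0# * _ + μ * (δ x0 j * 1#)  ≈⟨ +-cong (zeroˡ _) (*-congˡ (*-congʳ (reflexive (δ-≢ x0≢j)))) ⟩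
    0# + μ * (0# * 1#)          ≈⟨ trans (+-identityˡ _) (trans (*-congˡ (zeroˡ 1#)) (zeroʳ μ)) ⟩
    0#                          ∎
  ... | no  _      | yes ≡.refl = trans
    (+-cong (trans (*-identityˡ _) (zeroʳ _)) (trans (*-congˡ (zeroʳ _)) (zeroʳ μ))) (+-identityʳ 0#)

  ζ-ε-comm : ∀ b → ζ ⊙ ε b ≋ ε b ⊙ ζ
  ζ-ε-comm b i j = begin
    (ζ ⊙ ε b) i j      ≈⟨ ⊙-ε b ζ i j ⟩
    ζ i j * shell b j  ≈⟨ shells-commute ⟩
    shell b i * ζ i j  ≈⟨ ε-⊙ b ζ i j ⟨
    (ε b ⊙ ζ) i j      ∎
    where
    shells-commute : ζ i j * shell b j ≈ shell b i * ζ i j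
    shells-commute with does (x0 ≟ i) Bool.≟ does (x0 ≟ j)
    ... | yes same = trans (*-comm _ _)
                           (*-congʳ (reflexive (≡.cong (λ e → 𝔹 (not (not e xor b))) (≡.sym same))))
    ... | no differ = trans (*-congʳ (ζ-across differ))
                            (trans (zeroˡ _) (sym (trans (*-congˡ (ζ-across differ)) (zeroʳ _))))

  ζ-off-x0 : ∀ {i j} → x0 ≢ i → x0 ≢ j → ζ i j ≈ α true i j
  ζ-off-x0 {i} {j} x0≢i x0≢j rewrite dec-false (x0 ≟ i) x0≢i | dec-false (x0 ≟ j) x0≢j =
    trans (+-cong (trans (*-identityˡ _) (*-identityʳ _)) (trans (*-congˡ (zeroʳ _)) (zeroʳ μ)))
          (+-identityʳ _)

  γ-diag : ∀ i → γ i i ≈ 0#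
  γ-diag i = trans (ε-⊙ false (α true) i i) (trans (*-congˡ (reflexive (α-true-refl i))) (zeroʳ _))

  γ-col : ∀ {y} i → x0 ≢ y → γ i y ≈ δ i x0
  γ-col {y} i x0≢y = trans (ε-⊙ false (α true) i y) shell-α
    where
    shell-α : shell false i * α true i y ≈ δ i x0
    shell-α with i ≟ x0
    ... | yes ≡.refl rewrite dec-true (x0 ≟ x0) ≡.refl | α-true-≢ x0≢y = *-identityˡ 1#
    ... | no  i≢x0   rewrite dec-false (x0 ≟ i) (i≢x0 ∘ ≡.sym) = zeroˡ _

module Kronecker {c ℓ} (R : CommutativeRing c ℓ) {n} (u : Fin n → ℕ) where
  open CommutativeRing R hiding (zero)
  open Sums R
  open SquareMatrices R

  Family : Set c
  Family = (a : Fin n) → SqMat (u a)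

  infix 4 _≋ᶠ_
  _≋ᶠ_ : Family → Family → Set ℓ
  φ ≋ᶠ ψ = ∀ a → φ a ≋ ψ a

  infixl 7 _⊙ᶠ_
  _⊙ᶠ_ : Family → Family → Family
  (φ ⊙ᶠ ψ) a = φ a ⊙ ψ a

  δᶠ : Family
  δᶠ a = δ

  ⊗ : Family → Point u → Point u → Carrier
  ⊗ φ p q = prod (λ a → φ a (p a) (q a))

  ⊗-cong : ∀ {φ ψ} → φ ≋ᶠ ψ → ∀ p q → ⊗ φ p q ≈ ⊗ ψ p q
  ⊗-cong φ≋ψ p q = prod-cong (λ a → φ≋ψ a (p a) (q a))

  ⊗-mul : ∀ φ ψ p q → Σₚ u (λ w → ⊗ φ p w * ⊗ ψ w q) ≈ ⊗ (φ ⊙ᶠ ψ) p q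
  ⊗-mul φ ψ p q =
    trans (lsum-cong (allPoints u) (λ w →
             sym (prod-distrib-* (λ a → φ a (p a) (w a)) (λ a → ψ a (w a) (q a)))))
          (Σₚ-prod u (λ a k → φ a (p a) k * ψ a k (q a)))

  at : Fin n → Family → Family
  at b φ a = if does (a ≟ b) then φ a else δ

  at-self : ∀ b φ → at b φ b ≡ φ b
  at-self b φ rewrite dec-true (b ≟ b) ≡.refl = ≡.refl

  at-other : ∀ {a b} φ → a ≢ b → at b φ a ≡ δ
  at-other {a} {b} φ a≢b rewrite dec-false (a ≟ b) a≢b = ≡.refl

  at-self-≈ : ∀ b φ i j → at b φ b i j ≈ φ b i j
  at-self-≈ b φ i j = reflexive (≡.cong (λ M → M i j) (at-self b φ))

  at-other-≈ : ∀ {a b} φ i j → a ≢ b → at b φ a i j ≈ δ i j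
  at-other-≈ φ i j a≢b = reflexive (≡.cong (λ M → M i j) (at-other φ a≢b))

  ≋ᶠ-at : ∀ b φ ψ → φ b ≋ ψ b → (∀ a → a ≢ b → φ a ≋ δ) → φ ≋ᶠ at b ψ
  ≋ᶠ-at b φ ψ φb≋ψb φa≋δ a i j with a ≟ b
  ... | yes ≡.refl = φb≋ψb i j
  ... | no  a≢b    = φa≋δ a a≢b i j

  at-⊙ : ∀ b φ ψ → at b φ ⊙ᶠ at b ψ ≋ᶠ at b (φ ⊙ᶠ ψ)
  at-⊙ b φ ψ a with does (a ≟ b)
  ... | true  = λ _ _ → refl
  ... | false = δ-⊙ δ

  ⊗-at-linear : ∀ b φ ψ χ k → (∀ i j → φ b i j ≈ ψ b i j + k * χ b i j) →
                ∀ p q → ⊗ (at b φ) p q ≈ ⊗ (at b ψ) p q + k * ⊗ (at b χ) p q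
  ⊗-at-linear b φ ψ χ k φ≈ p q = prod-linear b _ _ _ k
    (trans (at-self-≈ b φ _ _) (trans (φ≈ (p b) (q b))
      (sym (+-cong (at-self-≈ b ψ _ _) (*-congˡ (at-self-≈ b χ _ _))))))
    (λ a a≢b → trans (at-other-≈ φ _ _ a≢b) (sym (at-other-≈ ψ _ _ a≢b)))
    (λ a a≢b → trans (at-other-≈ φ _ _ a≢b) (sym (at-other-≈ χ _ _ a≢b)))

  prefix : ℕ → Family → Family
  prefix k φ a = if does (Fin.toℕ a ℕ.<? k) then φ a else δ

  prefix-in : ∀ {k} φ {a} → Fin.toℕ a < k → prefix k φ a ≡ φ a
  prefix-in {k} φ {a} lt rewrite dec-true (Fin.toℕ a ℕ.<? k) lt = ≡.refl

  prefix-out : ∀ {k} φ {a} → ¬ Fin.toℕ a < k → prefix k φ a ≡ δ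
  prefix-out {k} φ {a} ≮ rewrite dec-false (Fin.toℕ a ℕ.<? k) ≮ = ≡.refl

  prefix-all : ∀ φ → prefix n φ ≋ᶠ φ
  prefix-all φ a i j = reflexive (≡.cong (λ M → M i j) (prefix-in φ (Finₚ.toℕ<n a)))

  module _ {k} (k<n : k < n) where
    private
      a≡k : ∀ {a} → Fin.toℕ a ≡ k → a ≡ Fin.fromℕ< k<n
      a≡k eq = Finₚ.toℕ-injective (≡.trans eq (≡.sym (Finₚ.toℕ-fromℕ< k<n)))

      a≢k : ∀ {a} → Fin.toℕ a ≢ k → a ≢ Fin.fromℕ< k<n
      a≢k ne a≡ = ne (≡.trans (≡.cong Fin.toℕ a≡) (Finₚ.toℕ-fromℕ< k<n))

    prefix-suc : ∀ φ → prefix (suc k) φ ≋ᶠ prefix k φ ⊙ᶠ at (Fin.fromℕ< k<n) φ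
    prefix-suc φ a with ℕₚ.<-cmp (Fin.toℕ a) k
    ... | tri< lt _ _ rewrite prefix-in φ (ℕₚ.m<n⇒m<1+n lt) | prefix-in φ lt
                            | at-other φ (a≢k (ℕₚ.<⇒≢ lt))
      = λ i j → sym (⊙-δ (φ a) i j)
    ... | tri≈ _ eq _ rewrite prefix-in φ (ℕₚ.≤-reflexive (≡.cong suc eq))
                            | prefix-out φ (ℕₚ.<-irrefl eq)
                            | ≡.sym (a≡k eq) | at-self a φ
      = λ i j → sym (δ-⊙ (φ a) i j)
    ... | tri> _ _ gt rewrite prefix-out φ (ℕₚ.<⇒≱ gt ∘ ℕ.s≤s⁻¹) | prefix-out φ (ℕₚ.<⇒≯ gt)
                            | at-other φ (a≢k (ℕₚ.>⇒≢ gt))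
      = λ i j → sym (δ-⊙ δ i j)

-- The centre of the Terwilliger algebra of the factorial scheme

module Centre {c ℓ} (F : Field c ℓ) {n} (u : Fin n → ℕ) (x : Point u) where
  open Field F hiding (zero)
  open Terwilliger F u x
  open Sums commutativeRing
  open SquareMatrices commutativeRing
  open Kronecker commutativeRing u
  module K (a : Fin n) = CompleteGraph commutativeRing (x a)
  open import Relation.Binary.Reasoning.Setoid setoid
  open import Algebra.Properties.CommutativeSemigroup *-commutativeSemigroup
    using (x∙yz≈y∙xz)
  open import Algebra.Properties.Ring ring using (-1*x≈-x; x∙y⁻¹≈ε⇒x≈y)

  private
    points = allPoints u

  ≈ₘ-refl : ∀ {M} → M ≈ₘ M
  ≈ₘ-refl p q = refl

  ≈ₘ-sym : ∀ {M N} → M ≈ₘ N → N ≈ₘ M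
  ≈ₘ-sym M≈N p q = sym (M≈N p q)

  ≈ₘ-trans : ∀ {M N L} → M ≈ₘ N → N ≈ₘ L → M ≈ₘ L
  ≈ₘ-trans M≈N N≈L p q = trans (M≈N p q) (N≈L p q)

  *ₘ-cong : ∀ {M M′ N N′} → M ≈ₘ M′ → N ≈ₘ N′ → (M *ₘ N) ≈ₘ (M′ *ₘ N′)
  *ₘ-cong M≈M′ N≈N′ p q = lsum-cong points (λ w → *-cong (M≈M′ p w) (N≈N′ w q))

  *ₘ-assoc : ∀ M N L → ((M *ₘ N) *ₘ L) ≈ₘ (M *ₘ (N *ₘ L))
  *ₘ-assoc M N L p q = begin
    Σₚ u (λ w → Σₚ u (λ v → M p v * N v w) * L w q)
      ≈⟨ lsum-cong points (λ w → *-distribʳ-lsum points (L w q) _) ⟩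
    Σₚ u (λ w → Σₚ u (λ v → M p v * N v w * L w q))
      ≈⟨ lsum-comm points points _ ⟩
    Σₚ u (λ v → Σₚ u (λ w → M p v * N v w * L w q))
      ≈⟨ lsum-cong points (λ v → trans (lsum-cong points (λ w → *-assoc _ _ _))
                                        (sym (*-distribˡ-lsum points (M p v) _))) ⟩
    Σₚ u (λ v → M p v * Σₚ u (λ w → N v w * L w q)) ∎

  *ₘ-distribˡ : ∀ M N L → (M *ₘ (N +ₘ L)) ≈ₘ ((M *ₘ N) +ₘ (M *ₘ L))
  *ₘ-distribˡ M N L p q =
    trans (lsum-cong points (λ w → distribˡ _ _ _)) (lsum-distrib-+ points _ _)

  *ₘ-distribʳ : ∀ M N L → ((N +ₘ L) *ₘ M) ≈ₘ ((N *ₘ M) +ₘ (L *ₘ M))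
  *ₘ-distribʳ M N L p q =
    trans (lsum-cong points (λ w → distribʳ _ _ _)) (lsum-distrib-+ points _ _)

  *ₘ-scaleˡ : ∀ k M N → ((k ·ₘ M) *ₘ N) ≈ₘ (k ·ₘ (M *ₘ N))
  *ₘ-scaleˡ k M N p q =
    trans (lsum-cong points (λ w → *-assoc _ _ _)) (sym (*-distribˡ-lsum points k _))

  *ₘ-scaleʳ : ∀ k M N → (M *ₘ (k ·ₘ N)) ≈ₘ (k ·ₘ (M *ₘ N))
  *ₘ-scaleʳ k M N p q =
    trans (lsum-cong points (λ w → x∙yz≈y∙xz _ _ _)) (sym (*-distribˡ-lsum points k _))

  *ₘ-zeroˡ : ∀ N → (0ₘ *ₘ N) ≈ₘ 0ₘ
  *ₘ-zeroˡ N p q = lsum-zero points _ (λ w → zeroˡ _)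

  *ₘ-zeroʳ : ∀ N → (N *ₘ 0ₘ) ≈ₘ 0ₘ
  *ₘ-zeroʳ N p q = lsum-zero points _ (λ w → zeroʳ _)

  lincomb-apply : ∀ {k} (cs : Vector Carrier k) Ms p q →
                  lincomb cs Ms p q ≈ sum (λ i → cs i * Ms i p q)
  lincomb-apply {zero}  cs Ms p q = refl
  lincomb-apply {suc k} cs Ms p q = +-congˡ (lincomb-apply (cs ∘ suc) (Ms ∘ suc) p q)

  Commute : Mat → Mat → Set ℓ
  Commute M N = (M *ₘ N) ≈ₘ (N *ₘ M)

  module _ {Z : Mat} where

    commute-sym : ∀ {M} → Commute Z M → Commute M Z
    commute-sym = ≈ₘ-sym

    commute-resp : ∀ {M N} → M ≈ₘ N → Commute Z M → Commute Z N
    commute-resp {M} {N} M≈N ZM p q = begin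
      (Z *ₘ N) p q  ≈⟨ *ₘ-cong {Z} ≈ₘ-refl (≈ₘ-sym M≈N) p q ⟩
      (Z *ₘ M) p q  ≈⟨ ZM p q ⟩
      (M *ₘ Z) p q  ≈⟨ *ₘ-cong M≈N (≈ₘ-refl {Z}) p q ⟩
      (N *ₘ Z) p q  ∎

    commute-0 : Commute Z 0ₘ
    commute-0 = ≈ₘ-trans (*ₘ-zeroʳ Z) (≈ₘ-sym (*ₘ-zeroˡ Z))

    commute-+ : ∀ {M N} → Commute Z M → Commute Z N → Commute Z (M +ₘ N)
    commute-+ {M} {N} ZM ZN p q = begin
      (Z *ₘ (M +ₘ N)) p q          ≈⟨ *ₘ-distribˡ Z M N p q ⟩
      (Z *ₘ M) p q + (Z *ₘ N) p q  ≈⟨ +-cong (ZM p q) (ZN p q) ⟩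
      (M *ₘ Z) p q + (N *ₘ Z) p q  ≈⟨ *ₘ-distribʳ Z M N p q ⟨
      ((M +ₘ N) *ₘ Z) p q          ∎

    commute-· : ∀ k {M} → Commute Z M → Commute Z (k ·ₘ M)
    commute-· k {M} ZM p q = begin
      (Z *ₘ (k ·ₘ M)) p q  ≈⟨ *ₘ-scaleʳ k Z M p q ⟩
      k * (Z *ₘ M) p q     ≈⟨ *-congˡ (ZM p q) ⟩
      k * (M *ₘ Z) p q     ≈⟨ *ₘ-scaleˡ k M Z p q ⟨
      ((k ·ₘ M) *ₘ Z) p q  ∎

    commute-* : ∀ {M N} → Commute Z M → Commute Z N → Commute Z (M *ₘ N)
    commute-* {M} {N} ZM ZN p q = begin
      (Z *ₘ (M *ₘ N)) p q  ≈⟨ *ₘ-assoc Z M N p q ⟨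
      ((Z *ₘ M) *ₘ N) p q  ≈⟨ *ₘ-cong ZM (≈ₘ-refl {N}) p q ⟩
      ((M *ₘ Z) *ₘ N) p q  ≈⟨ *ₘ-assoc M Z N p q ⟩
      (M *ₘ (Z *ₘ N)) p q  ≈⟨ *ₘ-cong (≈ₘ-refl {M}) ZN p q ⟩
      (M *ₘ (N *ₘ Z)) p q  ≈⟨ *ₘ-assoc M N Z p q ⟨
      ((M *ₘ N) *ₘ Z) p q  ∎

    commute-InT : (∀ g → Commute Z (A g)) → (∀ g → Commute Z (E* g)) →
                  ∀ {N} → InT N → Commute Z N
    commute-InT ZA ZE (genA g)     = ZA g
    commute-InT ZA ZE (genE g)     = ZE g
    commute-InT ZA ZE zeroT        = commute-0
    commute-InT ZA ZE (plus M N)   = commute-+ (commute-InT ZA ZE M) (commute-InT ZA ZE N)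
    commute-InT ZA ZE (scale k M)  = commute-· k (commute-InT ZA ZE M)
    commute-InT ZA ZE (times M N)  = commute-* (commute-InT ZA ZE M) (commute-InT ZA ZE N)
    commute-InT ZA ZE (resp M≈N M) = commute-resp M≈N (commute-InT ZA ZE M)

  InZ-0 : InZ 0ₘ
  InZ-0 = zeroT , λ N _ → commute-sym commute-0

  InZ-+ : ∀ {M N} → InZ M → InZ N → InZ (M +ₘ N)
  InZ-+ (M∈T , M-central) (N∈T , N-central) = plus M∈T N∈T , λ L L∈T →
    commute-sym (commute-+ (commute-sym (M-central L L∈T)) (commute-sym (N-central L L∈T)))

  InZ-· : ∀ k {M} → InZ M → InZ (k ·ₘ M)
  InZ-· k (M∈T , M-central) = scale k M∈T , λ L L∈T →
    commute-sym (commute-· k (commute-sym (M-central L L∈T)))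

  InZ-lincomb : ∀ {k} (cs : Vector Carrier k) Ms → (∀ i → InZ (Ms i)) → InZ (lincomb cs Ms)
  InZ-lincomb {zero}  cs Ms Ms∈Z = InZ-0
  InZ-lincomb {suc k} cs Ms Ms∈Z =
    InZ-+ (InZ-· (cs zero) (Ms∈Z zero)) (InZ-lincomb (cs ∘ suc) (Ms ∘ suc) (Ms∈Z ∘ suc))

  Extensional₂ : Mat → Set ℓ
  Extensional₂ M = ∀ {p p′ q q′} → p ≗ₚ p′ → q ≗ₚ q′ → M p q ≈ M p′ q′

  InT-extensional : ∀ {M} → InT M → Extensional₂ M
  InT-extensional (genA g) p≗p′ q≗q′ = reflexive (≡.cong bool (inR-cong g p≗p′ q≗q′))
  InT-extensional (genE g) p≗p′ q≗q′ = reflexive (≡.cong bool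
    (≡.cong₂ _∧_ (==ₚ-cong p≗p′ q≗q′) (inR-cong g {p = x} (λ _ → ≡.refl) p≗p′)))
  InT-extensional zeroT         _    _    = refl
  InT-extensional (plus M N)    p≗p′ q≗q′ =
    +-cong (InT-extensional M p≗p′ q≗q′) (InT-extensional N p≗p′ q≗q′)
  InT-extensional (scale k M)   p≗p′ q≗q′ = *-congˡ (InT-extensional M p≗p′ q≗q′)
  InT-extensional (times M N)   p≗p′ q≗q′ = lsum-cong points (λ w →
    *-cong (InT-extensional M p≗p′ (λ _ → ≡.refl)) (InT-extensional N (λ _ → ≡.refl) q≗q′))
  InT-extensional (resp M≈N M)  p≗p′ q≗q′ =
    trans (sym (M≈N _ _)) (trans (InT-extensional M p≗p′ q≗q′) (M≈N _ _))

  InT-invariant : ∀ {M} → InT M → (π : (a : Fin n) → Permutation′ (u a)) →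
                  (∀ a → π a ⟨$⟩ʳ x a ≡ x a) → ∀ p q → M (π ·ₚ p) (π ·ₚ q) ≈ M p q
  InT-invariant (genA g) π πx≡x p q = reflexive (≡.cong bool (inR-permute g π p q))
  InT-invariant (genE g) π πx≡x p q = reflexive (≡.cong bool (≡.cong₂ _∧_ (==ₚ-permute π p q)
    (≡.trans (inR-cong g (≡.sym ∘ πx≡x) (λ _ → ≡.refl)) (inR-permute g π x p))))
  InT-invariant zeroT       π πx≡x p q = refl
  InT-invariant (plus M N)  π πx≡x p q =
    +-cong (InT-invariant M π πx≡x p q) (InT-invariant N π πx≡x p q)
  InT-invariant (scale k M) π πx≡x p q = *-congˡ (InT-invariant M π πx≡x p q)
  InT-invariant (times {M} {N} M∈T N∈T) π πx≡x p q = begin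
    Σₚ u (λ w → M (π ·ₚ p) w * N w (π ·ₚ q))
      ≈⟨ Σₚ-permute π (λ w → M (π ·ₚ p) w * N w (π ·ₚ q)) (λ w≗w′ →
           *-cong (InT-extensional M∈T (λ _ → ≡.refl) w≗w′)
                  (InT-extensional N∈T w≗w′ (λ _ → ≡.refl))) ⟨
    Σₚ u (λ w → M (π ·ₚ p) (π ·ₚ w) * N (π ·ₚ w) (π ·ₚ q))
      ≈⟨ lsum-cong points (λ w →
           *-cong (InT-invariant M∈T π πx≡x p w) (InT-invariant N∈T π πx≡x w q)) ⟩
    Σₚ u (λ w → M p w * N w q) ∎
  InT-invariant (resp M≈N M) π πx≡x p q =
    trans (sym (M≈N _ _)) (trans (InT-invariant M π πx≡x p q) (M≈N p q))

  αᶠ εᶠ : Bool → Family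
  αᶠ b a = K.α a b
  εᶠ b a = K.ε a b

  ζᶠ γᶠ : Family
  ζᶠ a = K.ζ a
  γᶠ a = K.γ a

  A≈⊗ : ∀ g → A g ≈ₘ ⊗ (λ a → K.α a (lookup g a))
  A≈⊗ g p q = 𝔹-allB (λ a → not (not (does (p a ≟ q a)) xor lookup g a))

  E*≈⊗ : ∀ g → E* g ≈ₘ ⊗ (λ a → K.ε a (lookup g a))
  E*≈⊗ g p q = begin
    𝔹 ((p ==ₚ q) ∧ inR g x p)
      ≈⟨ 𝔹-∧ (p ==ₚ q) _ ⟩
    𝔹 (p ==ₚ q) * 𝔹 (inR g x p)
      ≈⟨ *-cong (𝔹-allB (λ a → does (p a ≟ q a)))
                (𝔹-allB (λ a → not (not (does (x a ≟ p a)) xor lookup g a))) ⟩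
    prod (λ a → δ (p a) (q a)) * prod (λ a → K.shell a (lookup g a) (p a))
      ≈⟨ prod-distrib-* (λ a → δ (p a) (q a)) (λ a → K.shell a (lookup g a) (p a)) ⟨
    ⊗ (λ a → K.ε a (lookup g a)) p q ∎

  ⊗-at-mul : ∀ b φ ψ → (⊗ (at b φ) *ₘ ⊗ (at b ψ)) ≈ₘ ⊗ (at b (φ ⊙ᶠ ψ))
  ⊗-at-mul b φ ψ p q = trans (⊗-mul (at b φ) (at b ψ) p q) (⊗-cong (at-⊙ b φ ψ) p q)

  ⊗δ∈T : InT (⊗ δᶠ)
  ⊗δ∈T = resp (λ p q → trans (A≈⊗ none p q) (⊗-cong α-none p q)) (genA none)
    where
    none = Vec.replicate n false
    α-none : (λ a → K.α a (lookup none a)) ≋ᶠ δᶠ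
    α-none a i j = trans (reflexive (≡.cong (λ b → K.α a b i j) (Vecₚ.lookup-replicate a false)))
                         (K.α-false a i j)

  α-at∈T : ∀ b → InT (⊗ (at b (αᶠ true)))
  α-at∈T b = resp (λ p q → trans (A≈⊗ only-b p q) (⊗-cong α-only-b p q)) (genA only-b)
    where
    only-b = Vec.tabulate (λ a → does (a ≟ b))
    lookup-only-b : ∀ a → lookup only-b a ≡ does (a ≟ b)
    lookup-only-b = Vecₚ.lookup∘tabulate _
    α-only-b : (λ a → K.α a (lookup only-b a)) ≋ᶠ at b (αᶠ true)
    α-only-b = ≋ᶠ-at b _ (αᶠ true)
      (λ i j → reflexive (≡.cong (λ e → K.α b e i j)
                                 (≡.trans (lookup-only-b b) (dec-true (b ≟ b) ≡.refl))))
      (λ a a≢b i j → trans (reflexive (≡.cong (λ e → K.α a e i j)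
                                              (≡.trans (lookup-only-b a) (dec-false (a ≟ b) a≢b))))
                           (K.α-false a i j))

  cube-InT : ∀ {m} (f : Vec Bool m → Mat) → (∀ v → InT (f v)) → InT (λ p q → cube (λ v → f v p q))
  cube-InT {zero}  f f∈T = f∈T []
  cube-InT {suc m} f f∈T = plus (cube-InT (λ v → f (false ∷ v)) (λ v → f∈T (false ∷ v)))
                                (cube-InT (λ v → f (true ∷ v)) (λ v → f∈T (true ∷ v)))

  -- ⊗ (at b (εᶠ t)) is the sum of the E*_g over the g with g_b = t, written as
  -- a sum over all g whose weights are products over the coordinates.
  ε-at∈T : ∀ b t → InT (⊗ (at b (εᶠ t)))
  ε-at∈T b t = resp sum≈ (cube-InT (λ g → weight g ·ₘ E* g) (λ g → scale (weight g) (genE g)))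
    where
    w : Fin n → Bool → Carrier
    w a s = if does (a ≟ b) then 𝔹 (does (s Bool.≟ t)) else 1#
    weight : Subset n → Carrier
    weight g = prod (λ a → w a (lookup g a))
    factor : Family
    factor a i j = w a false * K.ε a false i j + w a true * K.ε a true i j
    factor≋ : factor ≋ᶠ at b (εᶠ t)
    factor≋ = ≋ᶠ-at b factor (εᶠ t) at-b elsewhere
      where
      at-b : factor b ≋ εᶠ t b
      at-b i j rewrite dec-true (b ≟ b) ≡.refl = K.ε-select b t i j
      elsewhere : ∀ a → a ≢ b → factor a ≋ δ
      elsewhere a a≢b i j rewrite dec-false (a ≟ b) a≢b =
        trans (+-cong (*-identityˡ _) (*-identityˡ _)) (K.ε-sum a i j)
    sum≈ : (λ p q → cube (λ g → weight g * E* g p q)) ≈ₘ ⊗ (at b (εᶠ t))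
    sum≈ p q = begin
      cube (λ g → weight g * E* g p q)
        ≈⟨ cube-cong (λ g → trans (*-congˡ (E*≈⊗ g p q)) (sym (prod-distrib-*
             (λ a → w a (lookup g a)) (λ a → K.ε a (lookup g a) (p a) (q a))))) ⟩
      cube (λ g → prod (λ a → w a (lookup g a) * K.ε a (lookup g a) (p a) (q a)))
        ≈⟨ cube-prod (λ a s → w a s * K.ε a s (p a) (q a)) ⟩
      ⊗ factor p q
        ≈⟨ ⊗-cong factor≋ p q ⟩
      ⊗ (at b (εᶠ t)) p q ∎

  ζ-at∈T : ∀ b → InT (⊗ (at b ζᶠ))
  ζ-at∈T b = resp sum≈ (plus (times (ε-at∈T b true) (times (α-at∈T b) (ε-at∈T b true)))
                             (scale (K.μ b) (ε-at∈T b false)))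
    where
    E₁ = ⊗ (at b (εᶠ true))
    E₀ = ⊗ (at b (εᶠ false))
    sum≈ : ((E₁ *ₘ (⊗ (at b (αᶠ true)) *ₘ E₁)) +ₘ (K.μ b ·ₘ E₀)) ≈ₘ ⊗ (at b ζᶠ)
    sum≈ p q = begin
      (E₁ *ₘ (⊗ (at b (αᶠ true)) *ₘ E₁)) p q + K.μ b * E₀ p q
        ≈⟨ +-congʳ (*ₘ-cong (≈ₘ-refl {E₁}) (⊗-at-mul b (αᶠ true) (εᶠ true)) p q) ⟩
      (E₁ *ₘ ⊗ (at b (αᶠ true ⊙ᶠ εᶠ true))) p q + K.μ b * E₀ p q
        ≈⟨ +-congʳ (⊗-at-mul b (εᶠ true) (αᶠ true ⊙ᶠ εᶠ true) p q) ⟩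
      ⊗ (at b (εᶠ true ⊙ᶠ (αᶠ true ⊙ᶠ εᶠ true))) p q + K.μ b * E₀ p q
        ≈⟨ ⊗-at-linear b ζᶠ _ (εᶠ false) (K.μ b) (K.ζ-decomposition b) p q ⟨
      ⊗ (at b ζᶠ) p q ∎

  γ-at∈T : ∀ b → InT (⊗ (at b γᶠ))
  γ-at∈T b = resp (⊗-at-mul b (εᶠ false) (αᶠ true)) (times (ε-at∈T b false) (α-at∈T b))

  ⊗∈T : ∀ φ → (∀ b → InT (⊗ (at b φ))) → InT (⊗ φ)
  ⊗∈T φ at∈T = resp (⊗-cong (prefix-all φ)) (prefix∈T n ℕₚ.≤-refl)
    where
    prefix∈T : ∀ k → k ≤ n → InT (⊗ (prefix k φ))
    prefix∈T zero    _   = ⊗δ∈T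
    prefix∈T (suc k) k<n = resp
      (λ p q → trans (⊗-mul (prefix k φ) (at (Fin.fromℕ< k<n) φ) p q)
                     (⊗-cong (λ a i j → sym (prefix-suc k<n φ a i j)) p q))
      (times (prefix∈T k (ℕₚ.<⇒≤ k<n)) (at∈T (Fin.fromℕ< k<n)))

  Zᶠ : (Fin n → Bool) → Family
  Zᶠ s a = if s a then K.ζ a else δ

  Z : (Fin n → Bool) → Mat
  Z s = ⊗ (Zᶠ s)

  Z∈T : ∀ s → InT (Z s)
  Z∈T s = ⊗∈T (Zᶠ s) at∈T
    where
    Zᶠ-at : ∀ {b e} → s b ≡ e → Zᶠ s b ≋ (if e then K.ζ b else δ)
    Zᶠ-at {b} sb≡e i j = reflexive (≡.cong (λ e → (if e then K.ζ b else δ) i j) sb≡e)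
    at∈T : ∀ b → InT (⊗ (at b (Zᶠ s)))
    at∈T b with s b in sb
    ... | true  = resp (⊗-cong (≋ᶠ-at b (at b ζᶠ) (Zᶠ s)
                                 (λ i j → trans (at-self-≈ b ζᶠ i j) (sym (Zᶠ-at sb i j)))
                                 (λ a a≢b i j → at-other-≈ ζᶠ i j a≢b)))
                       (ζ-at∈T b)
    ... | false = resp (⊗-cong (≋ᶠ-at b δᶠ (Zᶠ s) (λ i j → sym (Zᶠ-at sb i j)) (λ _ _ _ _ → refl)))
                       ⊗δ∈T

  ⊗-commute : ∀ φ ψ → φ ⊙ᶠ ψ ≋ᶠ ψ ⊙ᶠ φ → Commute (⊗ φ) (⊗ ψ)
  ⊗-commute φ ψ comm p q =
    trans (⊗-mul φ ψ p q) (trans (⊗-cong comm p q) (sym (⊗-mul ψ φ p q)))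

  Z-central : ∀ s → InZ (Z s)
  Z-central s = Z∈T s , λ N → commute-InT
    (λ g → commute-resp (≈ₘ-sym (A≈⊗ g))
                        (⊗-commute (Zᶠ s) _ (λ a → Zᶠ-comm a (K.ζ-α-comm a (lookup g a)))))
    (λ g → commute-resp (≈ₘ-sym (E*≈⊗ g))
                        (⊗-commute (Zᶠ s) _ (λ a → Zᶠ-comm a (K.ζ-ε-comm a (lookup g a)))))
    where
    Zᶠ-comm : ∀ a {ψ} → K.ζ a ⊙ ψ ≋ ψ ⊙ K.ζ a → Zᶠ s a ⊙ ψ ≋ ψ ⊙ Zᶠ s a
    Zᶠ-comm a ζψ with s a
    ... | true  = ζψ
    ... | false = δ-comm _

  *ₘ-E*ʳ : ∀ {M} → Extensional₂ M → ∀ g p q → (M *ₘ E* g) p q ≈ M p q * bool (inR g x q)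
  *ₘ-E*ʳ {M} M-ext g p q = begin
    Σₚ u (λ w → M p w * bool ((w ==ₚ q) ∧ inR g x w))
      ≈⟨ lsum-cong points (λ w →
           trans (*-congˡ (trans (𝔹-∧ (w ==ₚ q) _) (*-comm _ _))) (sym (*-assoc _ _ _))) ⟩
    Σₚ u (λ w → M p w * bool (inR g x w) * 𝔹 (w ==ₚ q))
      ≈⟨ Σₚ-δʳ q (λ w → M p w * bool (inR g x w)) (λ w≗w′ →
           *-cong (M-ext (λ _ → ≡.refl) w≗w′)
                  (reflexive (≡.cong bool (inR-cong g {p = x} (λ _ → ≡.refl) w≗w′)))) ⟩
    M p q * bool (inR g x q) ∎

  E*-*ₘˡ : ∀ {M} → Extensional₂ M → ∀ g p q → (E* g *ₘ M) p q ≈ bool (inR g x p) * M p q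
  E*-*ₘˡ {M} M-ext g p q = begin
    Σₚ u (λ w → bool ((p ==ₚ w) ∧ inR g x p) * M w q)
      ≈⟨ lsum-cong points (λ w → trans (*-congʳ (𝔹-∧ (p ==ₚ w) _)) (*-assoc _ _ _)) ⟩
    Σₚ u (λ w → 𝔹 (p ==ₚ w) * (bool (inR g x p) * M w q))
      ≈⟨ Σₚ-δ p (λ w → bool (inR g x p) * M w q) (λ w≗w′ → *-congˡ (M-ext w≗w′ (λ _ → ≡.refl))) ⟩
    bool (inR g x p) * M p q ∎

  shellOf : Point u → Subset n
  shellOf q = Vec.tabulate (λ a → not (does (x a ≟ q a)))

  inR-shellOf : ∀ q w →
                inR (shellOf q) x w ≡ allB (λ a → does (does (x a ≟ w a) Bool.≟ does (x a ≟ q a)))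
  inR-shellOf q w = allB-cong (λ a → ≡.trans
    (≡.cong (λ e → not (not (does (x a ≟ w a)) xor e)) (Vecₚ.lookup∘tabulate _ a))
    (xnor-not (does (x a ≟ w a)) (does (x a ≟ q a))))

  InZ-shell : ∀ {D} → InZ D → ∀ {p q} c → does (x c ≟ p c) ≢ does (x c ≟ q c) → D p q ≈ 0#
  InZ-shell {D} (D∈T , D-central) {p} {q} c differ = begin
    D p q                               ≈⟨ *-identityʳ _ ⟨
    D p q * 1#                          ≈⟨ *-congˡ (reflexive (≡.cong bool q-in-shell)) ⟨
    D p q * bool (inR (shellOf q) x q)  ≈⟨ *ₘ-E*ʳ D-ext (shellOf q) p q ⟨
    (D *ₘ E* (shellOf q)) p q           ≈⟨ D-central (E* (shellOf q)) (genE (shellOf q)) p q ⟩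
    (E* (shellOf q) *ₘ D) p q           ≈⟨ E*-*ₘˡ D-ext (shellOf q) p q ⟩
    bool (inR (shellOf q) x p) * D p q  ≈⟨ *-congʳ (reflexive (≡.cong bool p-off-shell)) ⟩
    0# * D p q                          ≈⟨ zeroˡ _ ⟩
    0#                                  ∎
    where
    D-ext = InT-extensional D∈T
    q-in-shell : inR (shellOf q) x q ≡ true
    q-in-shell = ≡.trans (inR-shellOf q q)
                         (allB-true (λ a → dec-true (does (x a ≟ q a) Bool.≟ _) ≡.refl))
    p-off-shell : inR (shellOf q) x p ≡ false
    p-off-shell = ≡.trans (inR-shellOf q p)
      (allB-false {f = λ a → does (does (x a ≟ p a) Bool.≟ does (x a ≟ q a))} c
                  (dec-false (_ Bool.≟ _) differ))

  module Canonical (2≤u : ∀ a → 2 ≤ u a) where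

    y : Point u
    y a = other (2≤u a) (x a)

    x≢y : ∀ a → x a ≢ y a
    x≢y a = other-≢ (2≤u a) (x a)

    y′ : Point u
    y′ a with 2 ℕ.<? u a
    ... | yes 2<u = third 2<u (x a) (y a)
    ... | no  _   = y a

    y′-fresh : ∀ a → 2 < u a → x a ≢ y′ a × y a ≢ y′ a
    y′-fresh a 2<u with 2 ℕ.<? u a
    ... | yes 2<u′ = third-≢ 2<u′ (x a) (y a)
    ... | no  2≮u  = ⊥-elim (2≮u 2<u)

    large : Fin n → Bool
    large a = does (2 ℕ.<? u a)

    canonical : (Fin n → Bool) → Point u
    canonical t a = if t a then y′ a else y a

    Z-factor : ∀ s t a → (T (t a) → 2 < u a) →
               Zᶠ s a (y a) (canonical t a) ≈ 𝔹 (does (s a Bool.≟ t a))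
    Z-factor s t a large-a with s a | t a
    ... | false | false = reflexive (δ-refl (y a))
    ... | false | true  = reflexive (δ-≢ (proj₂ (y′-fresh a (large-a tt))))
    ... | true  | false = trans (K.ζ-off-x0 a (x≢y a) (x≢y a)) (reflexive (K.α-true-refl a (y a)))
    ... | true  | true  = trans (K.ζ-off-x0 a (x≢y a) (proj₁ (y′-fresh a (large-a tt))))
                                (reflexive (K.α-true-≢ a (proj₂ (y′-fresh a (large-a tt)))))

    basis : Fin (2 ^ n₂ u) → Mat
    basis i = Z (subset large i)

    canonicalᵢ : Fin (2 ^ n₂ u) → Point u
    canonicalᵢ j = canonical (subset large j)

    basis-canonical : ∀ i j → basis i y (canonicalᵢ j) ≈ δ i j
    basis-canonical i j with i ≟ j
    ... | yes ≡.refl = prod-one _ (λ a →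
      trans (Z-factor sᵢ sᵢ a (sᵢ-large a)) (reflexive (≡.cong 𝔹 (dec-true (sᵢ a Bool.≟ sᵢ a) ≡.refl))))
      where
      sᵢ = subset large i
      sᵢ-large : ∀ a → T (sᵢ a) → 2 < u a
      sᵢ-large a = T-does⇒ (2 ℕ.<? u a) ∘ subset-⊆ large i a
    ... | no  i≢j with a , differ ← ¬∀⟶∃¬ n _ (λ a → subset large i a Bool.≟ subset large j a)
                                              (i≢j ∘ subset-injective large)
      = prod-zero _ a (trans (Z-factor (subset large i) (subset large j) a
                                       (T-does⇒ (2 ℕ.<? u a) ∘ subset-⊆ large j a))
                             (reflexive (≡.cong 𝔹 (dec-false (_ Bool.≟ _) differ))))

    lincomb-canonical : ∀ cs j → lincomb cs basis y (canonicalᵢ j) ≈ cs j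
    lincomb-canonical cs j = begin
      lincomb cs basis y (canonicalᵢ j)
        ≈⟨ lincomb-apply cs basis y (canonicalᵢ j) ⟩
      sum (λ i → cs i * basis i y (canonicalᵢ j))
        ≈⟨ sum-cong-≋ {2 ^ n₂ u} (λ i → *-congˡ (basis-canonical i j)) ⟩
      sum (λ i → cs i * δ i j)
        ≈⟨ sum-δʳ j cs ⟩
      cs j ∎

    independent : LinIndep basis
    independent cs lincomb≈0 j = trans (sym (lincomb-canonical cs j)) (lincomb≈0 y (canonicalᵢ j))

    module Vanishing {D} (D∈Z : InZ D) (D-canonical : ∀ t → t ⊆ᵇ large → D y (canonical t) ≈ 0#)
      where
      private
        D∈T = proj₁ D∈Z
        D-central = proj₂ D∈Z
        D-ext = InT-extensional D∈T

      differ : Point u → Point u → Fin n → Bool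
      differ p q a = not (does (p a ≟ q a))

      off-x : ∀ {p q} → (∀ a → x a ≢ p a) → (∀ a → x a ≢ q a) → D p q ≈ 0#
      off-x {p} {q} x≢p x≢q = begin
        D p q                         ≈⟨ InT-invariant D∈T π (proj₁ ∘ moves) p q ⟨
        D (π ·ₚ p) (π ·ₚ q)           ≈⟨ D-ext (proj₁ ∘ proj₂ ∘ moves) (proj₂ ∘ proj₂ ∘ moves) ⟩
        D y (canonical (differ p q))  ≈⟨ D-canonical (differ p q) differ⊆large ⟩
        0#                            ∎
        where
        3≤u : ∀ {a} → p a ≢ q a → 3 ≤ u a
        3≤u {a} = distinct⇒3≤ (x≢p a) (x≢q a)
        differ⊆large : differ p q ⊆ᵇ large
        differ⊆large a = ⇒T-does (2 ℕ.<? u a) ∘ 3≤u ∘ T-not-does⇒ (p a ≟ q a)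
        move : ∀ a → ∃ λ (π : Permutation′ (u a)) →
               π ⟨$⟩ʳ x a ≡ x a × π ⟨$⟩ʳ p a ≡ y a × π ⟨$⟩ʳ q a ≡ canonical (differ p q) a
        move a with p a ≟ q a
        ... | yes p≡q = fixing-permutation (x≢p a) (x≢q a) (x≢y a) (x≢y a) (λ _ → ≡.refl) (λ _ → p≡q)
        ... | no  p≢q = fixing-permutation (x≢p a) (x≢q a) (x≢y a) (proj₁ fresh)
                                           (⊥-elim ∘ p≢q) (⊥-elim ∘ proj₂ fresh)
          where fresh = y′-fresh a (3≤u p≢q)
        π = proj₁ ∘ move
        moves = proj₂ ∘ move

      -- With Γ the element γ placed at c and q′ = q with y at c, D p q = (D Γ) p q′
      -- = (Γ D) p q′, and Γ D only involves rows agreeing with p off c and avoiding x at c.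
      lower : ∀ {S} c {p q} → (∀ {w q′} → (∀ a → x a ≡ w a → a ∈ S) → D w q′ ≈ 0#) →
              x c ≡ p c → x c ≡ q c → (∀ a → x a ≡ p a → a ∈ c ∷ S) → D p q ≈ 0#
      lower {S} c {p} {q} IH x≡p x≡q p-avoids = begin
        D p q                             ≈⟨ Σₚ-δʳ q (D p) (D-ext (λ _ → ≡.refl)) ⟨
        Σₚ u (λ w → D p w * 𝔹 (w ==ₚ q))  ≈⟨ lsum-cong points (λ w → *-congˡ (Γ-col w)) ⟨
        (D *ₘ Γ) p q′                     ≈⟨ D-central Γ (γ-at∈T c) p q′ ⟩
        (Γ *ₘ D) p q′                     ≈⟨ lsum-zero points _ Γ-row-term ⟩
        0#                                ∎
        where
        Γ = ⊗ (at c γᶠ)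
        q′ : Point u
        q′ a = if does (a ≟ c) then y a else q a
        Γ-col : ∀ w → Γ w q′ ≈ 𝔹 (w ==ₚ q)
        Γ-col w = trans (prod-cong factor) (sym (𝔹-allB (λ a → does (w a ≟ q a))))
          where
          factor : ∀ a → at c γᶠ a (w a) (q′ a) ≈ δ (w a) (q a)
          factor a with a ≟ c
          ... | yes ≡.refl = trans (K.γ-col a (w a) (x≢y a)) (reflexive (≡.cong (δ (w a)) x≡q))
          ... | no  _      = refl
        Γ-row-term : ∀ w → Γ p w * D w q′ ≈ 0#
        Γ-row-term w with all? (λ a → (a ≟ c) ⊎-dec (p a ≟ w a))
        ... | no ¬agree with a , ¬a≡c⊎p≡w ← ¬∀⟶∃¬ n _ (λ a → (a ≟ c) ⊎-dec (p a ≟ w a)) ¬agree =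
          trans (*-congʳ (prod-zero _ a (trans (at-other-≈ γᶠ _ _ (¬a≡c⊎p≡w ∘ inj₁))
                                               (reflexive (δ-≢ (¬a≡c⊎p≡w ∘ inj₂))))))
                (zeroˡ _)
        ... | yes agree with x c ≟ w c
        ...   | yes x≡w = trans (*-congʳ (prod-zero _ c (trans (at-self-≈ c γᶠ _ _)
                            (≡.subst (λ k → K.γ c (p c) k ≈ 0#) (≡.trans (≡.sym x≡p) x≡w)
                                     (K.γ-diag c (p c))))))
                          (zeroˡ _)
        ...   | no  x≢w = trans (*-congˡ (IH w-avoids)) (zeroʳ _)
          where
          w-avoids : ∀ a → x a ≡ w a → a ∈ S
          w-avoids a x≡w′ with agree a
          ... | inj₁ ≡.refl = ⊥-elim (x≢w x≡w′)
          ... | inj₂ p≡w with p-avoids a (≡.trans x≡w′ (≡.sym p≡w))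
          ...   | here ≡.refl = ⊥-elim (x≢w x≡w′)
          ...   | there a∈S  = a∈S

      avoiding : ∀ S {p q} → (∀ a → x a ≡ p a → a ∈ S) → D p q ≈ 0#
      avoiding [] {p} {q} p-avoids with any? (λ a → x a ≟ q a)
      ... | yes (c , x≡q) = InZ-shell D∈Z c (does-≢ {A? = x c ≟ p c} {B? = x c ≟ q c}
                                               (λ x≡p → case p-avoids c x≡p of λ ()) x≡q)
      ... | no  ¬x≡q      = off-x (λ a x≡p → case p-avoids a x≡p of λ ()) (λ a x≡q → ¬x≡q (a , x≡q))
      avoiding (c ∷ S) {p} {q} p-avoids with x c ≟ p c
      ... | no x≢p = avoiding S p-avoids′
        where
        p-avoids′ : ∀ a → x a ≡ p a → a ∈ S
        p-avoids′ a x≡p with p-avoids a x≡p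
        ... | here ≡.refl = ⊥-elim (x≢p x≡p)
        ... | there a∈S  = a∈S
      ... | yes x≡p with x c ≟ q c
      ...   | no  x≢q = InZ-shell D∈Z c (does-≢ {A? = x c ≟ q c} {B? = x c ≟ p c} x≢q x≡p ∘ ≡.sym)
      ...   | yes x≡q = lower c (avoiding S) x≡p x≡q p-avoids

      vanishes : ∀ p q → D p q ≈ 0#
      vanishes p q = avoiding (allFin n) (λ a _ → ∈-allFin a)

    spans : ∀ M → InZ M → ∃ λ cs → M ≈ₘ lincomb cs basis
    spans M M∈Z = cs , λ p q → x∙y⁻¹≈ε⇒x≈y _ _
      (trans (+-congˡ (sym (-1*x≈-x _))) (Vanishing.vanishes D∈Z D-canonical p q))
      where
      cs : Vector Carrier (2 ^ n₂ u)
      cs j = M y (canonicalᵢ j)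
      D = M +ₘ ((- 1#) ·ₘ lincomb cs basis)
      D∈Z : InZ D
      D∈Z = InZ-+ M∈Z (InZ-· (- 1#) (InZ-lincomb cs basis (Z-central ∘ subset large)))
      D-canonical : ∀ t → t ⊆ᵇ large → D y (canonical t) ≈ 0#
      D-canonical t t⊆large with j , sⱼ≗t ← subset-surjective large t t⊆large = begin
        D y (canonical t)
          ≈⟨ InT-extensional (proj₁ D∈Z) (λ _ → ≡.refl) t≗sⱼ ⟩
        M y (canonicalᵢ j) + - 1# * lincomb cs basis y (canonicalᵢ j)
          ≈⟨ +-congˡ (trans (*-congˡ (lincomb-canonical cs j)) (-1*x≈-x _)) ⟩
        cs j - cs j
          ≈⟨ -‿inverseʳ _ ⟩
        0# ∎
        where
        t≗sⱼ : canonical t ≗ₚ canonicalᵢ j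
        t≗sⱼ a = ≡.cong (λ b → if b then y′ a else y a) (≡.sym (sⱼ≗t a))

    centre-basis : HasDim InZ (2 ^ n₂ u)
    centre-basis = basis , Z-central ∘ subset large , independent , spans

corollary5p10 : ∀ {c ℓ : Level} (F : Field c ℓ) (n : ℕ) → 1 ≤ n →
    (u : Fin n → ℕ) → (∀ a → 2 ≤ u a) → (x : Point u) →
    Terwilliger.HasDim F u x (Terwilliger.InZ F u x) (2 ^ n₂ u)
corollary5p10 F n _ u 2≤u x = Centre.Canonical.centre-basis F u x 2≤u
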